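{- Let $n$ be a positive integer and $q=(q_1,\ldots,q_{d-1},n)\in\mathbb{Z}^d$, set $q_d=1-\sum_{j=1}^{d-1}q_j$, and assume $q_i\mid n$ for all $i=1,\ldots,d$. Let $$L_1(x)=\sum_{j=0}^{n-1}x^{\sum_{i=1}^d\left\lceil\frac{q_ij+q_i^+}{n}\right\rceil-1},\qquad L_2(x)=h^*_{\Delta(0,q)}(x)-\sum_{j=0}^{n-1}x^{\sum_{i=1}^d\left\lceil\frac{q_ij+q_i^+}{n}\right\rceil}$$ (these are the unique polynomials with $h^*_{\Delta(0,q^{(m)})}(x)=mxL_1(x)+L_2(x)$ for all positive integers $m$, where $q^{(m)}=(q_1,\ldots,q_{d-1},mn)$). Then $L_1(1)=n$, $L_2(0)=1$, and $L_2(1)=0$.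
   Context: For integer $a$, $a^+=\max(0,a)$. For $p=(p_1,\ldots,p_{d-1},N)\in\mathbb{Z}^d$ with $N\neq0$, $\Delta(0,p)=\mathrm{conv}\{\mathbf{0},\mathbf{e}_1,\ldots,\mathbf{e}_{d-1},N\mathbf{e}_d+\sum_{i=1}^{d-1}p_i\mathbf{e}_i\}\subset\mathbb{R}^d$ with $\mathbf{e}_i$ the unit coordinate vectors. For a $d$-dimensional integral polytope $\mathcal{P}$ with Ehrhart polynomial $i(\mathcal{P},t)=\#(t\mathcal{P}\cap\mathbb{Z}^d)$, the $h^*$-polynomial is defined by $1+\sum_{t\geq1}i(\mathcal{P},t)x^t=h^*_{\mathcal{P}}(x)/(1-x)^{d+1}$. -}

module Defs where

open import Data.Nat as ℕ using (ℕ; zero; suc; NonZero)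
open import Data.Nat.Combinatorics using (_C_)
open import Data.Integer as ℤ
  using (ℤ; +_; -[1+_]; -_; _+_; _-_; _*_; _≤_; _<_; ∣_∣; _⊔_; 0ℤ; 1ℤ; _/ℕ_)
open import Data.Integer.Properties using (_≤?_; _≟_)
open import Data.Vec as V using (Vec; []; _∷_)
open import Data.List as L using (List)
open import Data.Bool using (Bool; true; false; if_then_else_; _∧_)
open import Data.Product using (Σ; _×_)
open import Data.Sum using (_⊎_)
open import Relation.Nullary using (does)
open import Relation.Binary.PropositionalEquality using (_≡_)

_⁺ : ℤ → ℤ
a ⁺ = a ⊔ 0ℤ

sumV : ∀ {k} → Vec ℤ k → ℤ
sumV = V.foldr _ _+_ 0ℤ

sumL : List ℤ → ℤ
sumL = L.foldr _+_ 0ℤ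

countB : {A : Set} → (A → Bool) → List A → ℕ
countB p = L.foldr (λ a acc → if p a then suc acc else acc) zero

-- ⌈ a / n ⌉ for n > 0  (_/ℕ_ is floor division for positive divisor)
ceilDiv : ℤ → (n : ℕ) → .{{NonZero n}} → ℤ
ceilDiv a n = - ((- a) /ℕ n)

range : ℕ → List ℤ
range B = L.map (λ i → + i - + B) (L.upTo (suc (B ℕ.+ B)))

allVecs : (k : ℕ) → List ℤ → List (Vec ℤ k)
allVecs zero    xs = [] L.∷ L.[]
allVecs (suc k) xs = L.concatMap (λ x → L.map (x ∷_) (allVecs k xs)) xs

-- The simplex Δ(0,p) ⊂ ℝ^d, d = suc k, p = (p₁,…,p_k, N), N ≠ 0:
-- conv{0, e₁,…,e_k, N e_d + Σ pᵢ eᵢ}.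
-- A point is written (x', x_d) with x' = (x₁,…,x_k).
-- Since the vertices are affinely independent, x ∈ t·Δ(0,p) iff its
-- (unique) barycentric coordinates are all ≥ 0, namely
--   λ_d = x_d / N,  λ_i = x_i − p_i x_d / N  (1 ≤ i ≤ k),
--   λ_0 = t − Σ_{i≥1} λ_i .
-- We use μ = N·λ (integers) and test λ ≥ 0 as 0 ≤ N·μ.

module _ {k : ℕ} (p : Vec ℤ k) (N : ℤ) where

  inDilate : ℕ → Vec ℤ k → ℤ → Bool
  inDilate t x' xd =
    let μs  = V.zipWith (λ xi pi → N * xi - pi * xd) x' p
        μd  = xd
        μ0  = N * + t - sumV μs - μd
        nn  = λ μ → does (0ℤ ≤? N * μ)
    in nn μ0 ∧ nn μd ∧ V.foldr _ (λ μ b → nn μ ∧ b) true μs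

  -- every coordinate of a point of tΔ(0,p) has absolute value ≤ t·M
  boxM : ℕ
  boxM = suc (∣ N ∣ ℕ.+ V.foldr _ (λ a b → ∣ a ∣ ℕ.+ b) zero p)

  ehrhart : ℕ → ℕ
  ehrhart t =
    let B = t ℕ.* boxM in
    L.foldr ℕ._+_ zero (L.map (λ xd → countB (λ x' → inDilate t x' xd) (allVecs k (range B)))
                 (range B))

  ehrhartSeries : ℕ → ℤ
  ehrhartSeries zero    = 1ℤ
  ehrhartSeries (suc t) = + ehrhart (suc t)

  -- h*-polynomial: h*(x) = (1-x)^{d+1} · (1 + Σ_{t≥1} i(Δ,t) x^t), d = suc k,
  -- coefficient of x^m (as a function of an integer exponent, 0 for m < 0)
  hstarℕ : ℕ → ℤ
  hstarℕ m = sumL (L.map (λ j → sgn j * + ((suc (suc k)) C j) * ehrhartSeries (m ℕ.∸ j))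
                         (L.upTo (suc m)))
    where
    sgn : ℕ → ℤ
    sgn zero          = 1ℤ
    sgn (suc zero)    = - 1ℤ
    sgn (suc (suc j)) = sgn j

  hstar : ℤ → ℤ
  hstar (+ m)     = hstarℕ m
  hstar -[1+ _ ]  = 0ℤ

-- Laurent polynomials as coefficient functions ℤ → ℤ (exponent ↦ coeff).
-- "c is a polynomial whose value at 1 is v":
-- c vanishes outside [0,B] for some B and Σ_{m=0}^{B} c m = v.
PolyValueAt1 : (ℤ → ℤ) → ℤ → Set
PolyValueAt1 c v =
  Σ ℕ λ B → (∀ e → (e < 0ℤ ⊎ + B < e) → c e ≡ 0ℤ)
          × sumL (L.map (λ m → c (+ m)) (L.upTo (suc B))) ≡ v
-- (for a polynomial, its value at 0 is its coefficient c 0ℤ)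

-- Data of Proposition 5.3: q = (q₁,…,q_k, n), d = suc k.

module _ {k : ℕ} (qs : Vec ℤ k) (n : ℕ) .{{_ : NonZero n}} where

  qd : ℤ
  qd = 1ℤ - sumV qs

  qAll : Vec ℤ (suc k)
  qAll = qs V.∷ʳ qd

  expo : ℕ → ℤ
  expo j = sumV (V.map (λ qi → ceilDiv (qi * + j + qi ⁺) n) qAll)

  L1 : ℤ → ℤ
  L1 e = + countB (λ j → does (expo j - 1ℤ ≟ e)) (L.upTo n)

  L2 : ℤ → ℤ
  L2 e = hstar qs (+ n) e - + countB (λ j → does (expo j ≟ e)) (L.upTo n)

-- Slicing tΔ(0,p) by its last coordinate y and substituting xᵢ = ⌈pᵢ y / n⌉ + zᵢ turns every
-- slice into a dilate of a standard (d−1)-simplex. Writing y = s n + j with 0 ≤ j < n, the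
-- rounding defects n⌈pᵢ y / n⌉ − pᵢ y depend only on j, and summing over s gives
--   i(Δ(0,p), t) = Σ_{j<n} C(t − h_j + d, d),  h_j = ⌈(j + Σᵢ (n⌈pᵢ j / n⌉ − pᵢ j)) / n⌉,
-- with h_j ≥ 0 and h₀ = 0. Taking d + 1 backward differences yields h*(x) = Σ_{j<n} x^{h_j},
-- so h*(0) = 1 and h*(1) = n. Since q₁ + ⋯ + q_d = 1, each exponent Σᵢ ⌈(qᵢ j + qᵢ⁺) / n⌉ is
-- at least (j + 1)/n > 0, hence L₁(1) = n, L₂(0) = h*(0) = 1 and L₂(1) = n − n = 0.

{-# OPTIONS --safe #-}
module Submission where

open import Defs
open import Data.Nat as ℕ using (ℕ; suc; zero; NonZero; _∸_; z≤n; s≤s)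
open import Data.Nat.Combinatorics using (_C_; nCk+nC[k+1]≡[n+1]C[k+1])
import Data.Nat.Properties as ℕP
open import Data.Integer as ℤ
  using (ℤ; +_; -[1+_]; 0ℤ; 1ℤ; -_; _+_; _-_; _*_; ∣_∣; _≤_; _<_; +≤+; +<+; -<+; _/ℕ_)
import Data.Integer.Properties as ℤP
import Data.List.Properties as LP
import Data.Integer.DivMod as DM
open import Data.Integer.Tactic.RingSolver using (solve-∀)
open import Data.List as L using (_∷_; []; _++_; applyUpTo)
open import Data.Bool using (Bool; true; false; if_then_else_; _∧_)
import Data.Bool.Properties as BP
open import Algebra.Bundles using (CommutativeMonoid)
open import Algebra.Properties.CommutativeSemigroup (CommutativeMonoid.commutativeSemigroup BP.∧-commutativeMonoid)
  using () renaming (x∙yz≈y∙xz to ∧-swap)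
open import Data.Nat.ListAction using (sum)
open import Data.Vec as V using (Vec; []; _∷_; lookup)
open import Data.Fin using (Fin)
open import Data.Integer.Divisibility using (_∣_)
open import Data.Vec.Relation.Unary.All as All using (All; []; _∷_)
open import Data.Product using (_×_; _,_; proj₁; proj₂)
open import Data.Sum using (_⊎_; inj₁; inj₂)
open import Function using (_∘_)
open import Relation.Nullary using (Dec; does; yes; no; contradiction)
open import Relation.Nullary.Decidable using (dec-true; dec-false)
open import Relation.Binary.PropositionalEquality

≤-witness : ∀ {u v} w → v - u ≡ w → 0ℤ ≤ w → u ≤ v
≤-witness w eq 0≤w = ℤP.0≤i-j⇒j≤i (subst (0ℤ ≤_) (sym eq) 0≤w)

<-witness : ∀ {u v} w → v - u - 1ℤ ≡ w → 0ℤ ≤ w → u < v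
<-witness {u} {v} w eq 0≤w = ℤP.suc[i]≤j⇒i<j (≤-witness w (trans (shift u v) eq) 0≤w)
  where
  shift : ∀ u v → v - (1ℤ + u) ≡ v - u - 1ℤ
  shift = solve-∀

<1+⇒≤ : ∀ {i j} → i < 1ℤ + j → i ≤ j
<1+⇒≤ {i} {j} i<1+j = ≤-witness (1ℤ + j - (1ℤ + i)) (shift i j) (ℤP.i≤j⇒0≤j-i (ℤP.i<j⇒suc[i]≤j i<1+j))
  where
  shift : ∀ i j → j - i ≡ 1ℤ + j - (1ℤ + i)
  shift = solve-∀

i-1<i : ∀ i → i - 1ℤ < i
i-1<i i = <-witness 0ℤ (cancel i) ℤP.≤-refl
  where
  cancel : ∀ i → i - (i - 1ℤ) - 1ℤ ≡ 0ℤ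
  cancel = solve-∀

δ : ℤ → ℤ → ℤ
δ a b = if does (a ℤ.≟ b) then 1ℤ else 0ℤ

δ-refl : ∀ a → δ a a ≡ 1ℤ
δ-refl a with a ℤ.≟ a
... | yes _   = refl
... | no a≢a = contradiction refl a≢a

δ-≢ : ∀ {a b} → a ≢ b → δ a b ≡ 0ℤ
δ-≢ {a} {b} a≢b with a ℤ.≟ b
... | yes a≡b = contradiction a≡b a≢b
... | no _    = refl

does-⇔ : ∀ {A B : Set} (a? : Dec A) (b? : Dec B) → (A → B) → (B → A) → does a? ≡ does b?
does-⇔ a? (yes b) _   B→A = dec-true a? (B→A b)
does-⇔ a? (no ¬b) A→B _   = dec-false a? (¬b ∘ A→B)

δ-+-0 : ∀ a e → δ (a + e) 0ℤ ≡ δ (- e) a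
δ-+-0 a e = cong (λ b → if b then 1ℤ else 0ℤ) (does-⇔ (a + e ℤ.≟ 0ℤ) (- e ℤ.≟ a) to from)
  where
  cancel : ∀ a e → a ≡ a + e - e
  cancel = solve-∀
  to : a + e ≡ 0ℤ → - e ≡ a
  to a+e≡0 = sym (trans (cancel a e) (trans (cong (_- e) a+e≡0) (ℤP.+-identityˡ (- e))))
  from : - e ≡ a → a + e ≡ 0ℤ
  from -e≡a = trans (cong (_+ e) (sym -e≡a)) (ℤP.+-inverseˡ e)

∑ : ℕ → (ℕ → ℤ) → ℤ
∑ zero    f = 0ℤ
∑ (suc L) f = f 0 + ∑ L (f ∘ suc)

infix 5 ∑
syntax ∑ L (λ i → e) = ∑[ i < L ] e

∑-cong : ∀ {f g : ℕ → ℤ} L → (∀ i → i ℕ.< L → f i ≡ g i) → ∑ L f ≡ ∑ L g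
∑-cong zero    eq = refl
∑-cong (suc L) eq = cong₂ _+_ (eq 0 ℕ.z<s) (∑-cong L (λ i i<L → eq (suc i) (s≤s i<L)))

∑-zero : ∀ {f : ℕ → ℤ} L → (∀ i → i ℕ.< L → f i ≡ 0ℤ) → ∑ L f ≡ 0ℤ
∑-zero zero    eq = refl
∑-zero (suc L) eq = cong₂ _+_ (eq 0 ℕ.z<s) (∑-zero L (λ i i<L → eq (suc i) (s≤s i<L)))

∑-+ : ∀ (f g : ℕ → ℤ) L → ∑[ i < L ] (f i + g i) ≡ ∑ L f + ∑ L g
∑-+ f g zero    = refl
∑-+ f g (suc L) = trans (cong (_+_ (f 0 + g 0)) (∑-+ (f ∘ suc) (g ∘ suc) L))
                        (interchange (f 0) (g 0) (∑ L (f ∘ suc)) (∑ L (g ∘ suc)))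
  where
  interchange : ∀ a b c d → a + b + (c + d) ≡ a + c + (b + d)
  interchange = solve-∀

∑-neg : ∀ (f : ℕ → ℤ) L → ∑[ i < L ] (- f i) ≡ - ∑ L f
∑-neg f zero    = refl
∑-neg f (suc L) = trans (cong (_+_ (- f 0)) (∑-neg (f ∘ suc) L)) (sym (ℤP.neg-distrib-+ (f 0) _))

∑-minus : ∀ (f g : ℕ → ℤ) L → ∑[ i < L ] (f i - g i) ≡ ∑ L f - ∑ L g
∑-minus f g L = trans (∑-+ f (λ i → - g i) L) (cong (_+_ (∑ L f)) (∑-neg g L))

∑-const : ∀ c L → ∑[ i < L ] c ≡ + L * c
∑-const c zero    = refl
∑-const c (suc L) = trans (cong (_+_ c) (∑-const c L)) (sym (ℤP.suc-* (+ L) c))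

∑-split : ∀ (f : ℕ → ℤ) a b → ∑ (a ℕ.+ b) f ≡ ∑ a f + (∑[ i < b ] f (a ℕ.+ i))
∑-split f zero    b = sym (ℤP.+-identityˡ _)
∑-split f (suc a) b = trans (cong (_+_ (f 0)) (∑-split (f ∘ suc) a b)) (sym (ℤP.+-assoc (f 0) _ _))

∑-extend : ∀ (f : ℕ → ℤ) {L L′} → L ℕ.≤ L′ → (∀ i → L ℕ.≤ i → f i ≡ 0ℤ) → ∑ L′ f ≡ ∑ L f
∑-extend f {L} {L′} L≤L′ vanish = begin
  ∑ L′ f
    ≡⟨ cong (λ l → ∑ l f) (sym (ℕP.m+[n∸m]≡n L≤L′)) ⟩
  ∑ (L ℕ.+ (L′ ∸ L)) f
    ≡⟨ ∑-split f L (L′ ∸ L) ⟩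
  ∑ L f + (∑[ i < L′ ∸ L ] f (L ℕ.+ i))
    ≡⟨ cong (_+_ (∑ L f)) (∑-zero (L′ ∸ L) (λ i _ → vanish (L ℕ.+ i) (ℕP.m≤m+n L i))) ⟩
  ∑ L f + 0ℤ
    ≡⟨ ℤP.+-identityʳ _ ⟩
  ∑ L f
    ∎
  where open ≡-Reasoning

∑-swap : ∀ (a : ℕ → ℕ → ℤ) m L → ∑[ s < L ] ∑[ j < m ] a s j ≡ ∑[ j < m ] ∑[ s < L ] a s j
∑-swap a m zero    = sym (∑-zero m (λ _ _ → refl))
∑-swap a m (suc L) = trans (cong (_+_ (∑ m (a 0))) (∑-swap (a ∘ suc) m L))
                           (sym (∑-+ (a 0) (λ j → ∑[ s < L ] a (suc s) j) m))

∑-blocks : ∀ (f : ℕ → ℤ) m L → ∑ (L ℕ.* m) f ≡ ∑[ s < L ] ∑[ j < m ] f (s ℕ.* m ℕ.+ j)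
∑-blocks f m zero    = refl
∑-blocks f m (suc L) = trans (∑-split f m (L ℕ.* m)) (cong (_+_ (∑ m f)) (trans
  (∑-blocks (λ i → f (m ℕ.+ i)) m L)
  (∑-cong L (λ s _ → ∑-cong m (λ j _ → cong f (sym (ℕP.+-assoc m (s ℕ.* m) j)))))))

sumL-applyUpTo : ∀ {A : Set} (g : A → ℤ) (u : ℕ → A) L → sumL (L.map g (applyUpTo u L)) ≡ ∑[ i < L ] g (u i)
sumL-applyUpTo g u zero    = refl
sumL-applyUpTo g u (suc L) = cong (_+_ (g (u 0))) (sumL-applyUpTo g (u ∘ suc) L)

sum-applyUpTo : ∀ {A : Set} (g : A → ℕ) (u : ℕ → A) L → + sum (L.map g (applyUpTo u L)) ≡ ∑[ i < L ] + g (u i)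
sum-applyUpTo g u zero    = refl
sum-applyUpTo g u (suc L) =
  trans (ℤP.pos-+ (g (u 0)) _) (cong (_+_ (+ g (u 0))) (sum-applyUpTo g (u ∘ suc) L))

sum-range : ∀ (g : ℤ → ℕ) B → + sum (L.map g (range B)) ≡ ∑[ i < suc (B ℕ.+ B) ] + g (+ i - + B)
sum-range g B = trans (cong (λ xs → + sum (L.map g xs)) (LP.map-applyUpTo (λ i → i) (λ i → + i - + B) (suc (B ℕ.+ B))))
                      (sum-applyUpTo g (λ i → + i - + B) (suc (B ℕ.+ B)))

countB-applyUpTo : ∀ (P : ℕ → Bool) u L →
  + countB P (applyUpTo u L) ≡ ∑[ i < L ] (if P (u i) then 1ℤ else 0ℤ)
countB-applyUpTo P u zero = refl
countB-applyUpTo P u (suc L) with P (u 0)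
... | true  = trans (ℤP.pos-+ 1 _) (cong (_+_ 1ℤ) (countB-applyUpTo P (u ∘ suc) L))
... | false = trans (countB-applyUpTo P (u ∘ suc) L) (sym (ℤP.+-identityˡ _))

countB-cong : ∀ {A : Set} {P Q : A → Bool} xs → (∀ x → P x ≡ Q x) → countB P xs ≡ countB Q xs
countB-cong []       P≗Q = refl
countB-cong (x ∷ xs) P≗Q rewrite P≗Q x = cong (λ c → if _ then suc c else c) (countB-cong xs P≗Q)

countB-++ : ∀ {A : Set} (P : A → Bool) xs ys → countB P (xs ++ ys) ≡ countB P xs ℕ.+ countB P ys
countB-++ P []       ys = refl
countB-++ P (x ∷ xs) ys with P x
... | true  = cong suc (countB-++ P xs ys)
... | false = countB-++ P xs ys

countB-map : ∀ {A B : Set} (P : B → Bool) (f : A → B) xs → countB P (L.map f xs) ≡ countB (P ∘ f) xs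
countB-map P f []       = refl
countB-map P f (x ∷ xs) with P (f x)
... | true  = cong suc (countB-map P f xs)
... | false = countB-map P f xs

countB-∧ : ∀ {A : Set} b (Q : A → Bool) xs → countB (λ x → b ∧ Q x) xs ≡ (if b then countB Q xs else 0)
countB-∧ true  Q xs       = refl
countB-∧ false Q []       = refl
countB-∧ false Q (x ∷ xs) = countB-∧ false Q xs

countB-allVecs : ∀ {k} (P : Vec ℤ (suc k) → Bool) xs →
  countB P (allVecs (suc k) xs) ≡ sum (L.map (λ x → countB (P ∘ (x ∷_)) (allVecs k xs)) xs)
countB-allVecs {k} P xs = go xs
  where
  go : ∀ ys → countB P (L.concatMap (λ x → L.map (x ∷_) (allVecs k xs)) ys)
            ≡ sum (L.map (λ x → countB (P ∘ (x ∷_)) (allVecs k xs)) ys)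
  go []       = refl
  go (y ∷ ys) = trans (countB-++ P (L.map (y ∷_) (allVecs k xs)) _)
                      (cong₂ ℕ._+_ (countB-map P (y ∷_) (allVecs k xs)) (go ys))

-- The coefficient of x^e in Σ_{j<L} x^{v j}.
monomials : ℕ → (ℕ → ℤ) → ℤ → ℤ
monomials L v e = ∑[ j < L ] δ (v j) e

countB-≟≡monomials : ∀ L (v : ℕ → ℤ) e → + countB (λ j → does (v j ℤ.≟ e)) (L.upTo L) ≡ monomials L v e
countB-≟≡monomials L v e = countB-applyUpTo (λ j → does (v j ℤ.≟ e)) (λ j → j) L

monomials-absent : ∀ L (v : ℕ → ℤ) e → (∀ j → j ℕ.< L → v j ≢ e) → monomials L v e ≡ 0ℤ
monomials-absent L v e absent = ∑-zero L (λ j j<L → δ-≢ (absent j j<L))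

∑-δ : ∀ {a L} → a ℕ.< L → ∑[ m < L ] δ (+ a) (+ m) ≡ 1ℤ
∑-δ {a} {L} a<L = begin
  ∑[ m < L ] δ (+ a) (+ m)
    ≡⟨ cong (λ l → ∑[ m < l ] δ (+ a) (+ m)) (sym (trans (ℕP.+-suc a r) (ℕP.m+[n∸m]≡n a<L))) ⟩
  ∑[ m < a ℕ.+ suc r ] δ (+ a) (+ m)
    ≡⟨ ∑-split (λ m → δ (+ a) (+ m)) a (suc r) ⟩
  (∑[ m < a ] δ (+ a) (+ m)) + (δ (+ a) (+ (a ℕ.+ 0)) + (∑[ i < r ] δ (+ a) (+ (a ℕ.+ suc i))))
    ≡⟨ cong₂ _+_ (∑-zero a (λ m m<a → δ-≢ (ℕP.>⇒≢ m<a ∘ ℤP.+-injective)))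
                 (cong₂ _+_ (trans (cong (δ (+ a) ∘ +_) (ℕP.+-identityʳ a)) (δ-refl (+ a)))
                            (∑-zero r (λ i _ → δ-≢ (ℕP.m≢1+m+n a ∘ trans′ i)))) ⟩
  0ℤ + (1ℤ + 0ℤ)
    ≡⟨⟩
  1ℤ
    ∎
  where
  open ≡-Reasoning
  r : ℕ
  r = L ∸ suc a
  trans′ : ∀ i → + a ≡ + (a ℕ.+ suc i) → a ≡ suc (a ℕ.+ i)
  trans′ i eq = trans (ℤP.+-injective eq) (ℕP.+-suc a i)

maxAbs : ℕ → (ℕ → ℤ) → ℕ
maxAbs zero    v = 0
maxAbs (suc L) v = ∣ v 0 ∣ ℕ.⊔ maxAbs L (v ∘ suc)

∣∣≤maxAbs : ∀ L (v : ℕ → ℤ) j → j ℕ.< L → ∣ v j ∣ ℕ.≤ maxAbs L v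
∣∣≤maxAbs (suc L) v zero    _         = ℕP.m≤m⊔n ∣ v 0 ∣ _
∣∣≤maxAbs (suc L) v (suc j) (s≤s j<L) = ℕP.≤-trans (∣∣≤maxAbs L (v ∘ suc) j j<L) (ℕP.m≤n⊔m ∣ v 0 ∣ _)

PolyValueAt1-monomials : ∀ L (v : ℕ → ℤ) → (∀ j → j ℕ.< L → 0ℤ ≤ v j) → PolyValueAt1 (monomials L v) (+ L)
PolyValueAt1-monomials L v nonNeg = B , vanish , value
  where
  open ≡-Reasoning
  B : ℕ
  B = maxAbs L v
  v≡ : ∀ j → j ℕ.< L → + ∣ v j ∣ ≡ v j
  v≡ j j<L = ℤP.0≤i⇒+∣i∣≡i (nonNeg j j<L)
  v≤B : ∀ j → j ℕ.< L → v j ≤ + B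
  v≤B j j<L = subst (_≤ + B) (v≡ j j<L) (+≤+ (∣∣≤maxAbs L v j j<L))
  vanish : ∀ e → e < 0ℤ ⊎ + B < e → monomials L v e ≡ 0ℤ
  vanish e (inj₁ e<0) = monomials-absent L v e (λ j j<L v≡e → ℤP.<⇒≱ e<0 (subst (0ℤ ≤_) v≡e (nonNeg j j<L)))
  vanish e (inj₂ B<e) = monomials-absent L v e (λ j j<L v≡e → ℤP.<⇒≱ B<e (subst (_≤ + B) v≡e (v≤B j j<L)))
  once : ∀ j → j ℕ.< L → ∑[ m < suc B ] δ (v j) (+ m) ≡ 1ℤ
  once j j<L = trans (∑-cong (suc B) (λ m _ → cong (λ w → δ w (+ m)) (sym (v≡ j j<L))))
                     (∑-δ (s≤s (∣∣≤maxAbs L v j j<L)))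
  value : sumL (L.map (λ m → monomials L v (+ m)) (L.upTo (suc B))) ≡ + L
  value = begin
    sumL (L.map (λ m → monomials L v (+ m)) (L.upTo (suc B)))
      ≡⟨ sumL-applyUpTo (λ m → monomials L v (+ m)) (λ m → m) (suc B) ⟩
    ∑[ m < suc B ] ∑[ j < L ] δ (v j) (+ m)
      ≡⟨ ∑-swap (λ m j → δ (v j) (+ m)) L (suc B) ⟩
    ∑[ j < L ] ∑[ m < suc B ] δ (v j) (+ m)
      ≡⟨ ∑-cong L once ⟩
    ∑[ j < L ] 1ℤ
      ≡⟨ ∑-const 1ℤ L ⟩
    + L * 1ℤ
      ≡⟨ ℤP.*-identityʳ (+ L) ⟩
    + L
      ∎

PolyValueAt1-cong : ∀ {f g : ℤ → ℤ} {a} → (∀ e → f e ≡ g e) → PolyValueAt1 f a → PolyValueAt1 g a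
PolyValueAt1-cong {f} {g} f≗g (B , vanish , value) =
  B , (λ e out → trans (sym (f≗g e)) (vanish e out)) , trans (cong sumL (sym (LP.map-cong (f≗g ∘ +_) (L.upTo (suc B))))) value

PolyValueAt1-sub : ∀ {f g : ℤ → ℤ} {a b} → PolyValueAt1 f a → PolyValueAt1 g b → PolyValueAt1 (λ e → f e - g e) (a - b)
PolyValueAt1-sub {f} {g} {a} {b} (Bf , vanish-f , value-f) (Bg , vanish-g , value-g) = B , vanish , value
  where
  open ≡-Reasoning
  B : ℕ
  B = Bf ℕ.⊔ Bg
  widen : ∀ {B′} → B′ ℕ.≤ B → ∀ {e} → + B < e → + B′ < e
  widen B′≤B = ℤP.≤-<-trans (+≤+ B′≤B)
  vanish : ∀ e → e < 0ℤ ⊎ + B < e → f e - g e ≡ 0ℤ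
  vanish e (inj₁ e<0) = cong₂ _-_ (vanish-f e (inj₁ e<0)) (vanish-g e (inj₁ e<0))
  vanish e (inj₂ B<e) = cong₂ _-_ (vanish-f e (inj₂ (widen (ℕP.m≤m⊔n Bf Bg) B<e)))
                                  (vanish-g e (inj₂ (widen (ℕP.m≤n⊔m Bf Bg) B<e)))
  restrict : ∀ (h : ℤ → ℤ) B′ → B′ ℕ.≤ B → (∀ e → e < 0ℤ ⊎ + B′ < e → h e ≡ 0ℤ) →
             ∑[ m < suc B ] h (+ m) ≡ sumL (L.map (λ m → h (+ m)) (L.upTo (suc B′)))
  restrict h B′ B′≤B vanish-h = trans (∑-extend (h ∘ +_) (s≤s B′≤B) (λ i B′<i → vanish-h (+ i) (inj₂ (+<+ B′<i))))
                                      (sym (sumL-applyUpTo (h ∘ +_) (λ m → m) (suc B′)))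
  value : sumL (L.map (λ m → f (+ m) - g (+ m)) (L.upTo (suc B))) ≡ a - b
  value = begin
    sumL (L.map (λ m → f (+ m) - g (+ m)) (L.upTo (suc B)))
      ≡⟨ sumL-applyUpTo (λ m → f (+ m) - g (+ m)) (λ m → m) (suc B) ⟩
    ∑[ m < suc B ] (f (+ m) - g (+ m))
      ≡⟨ ∑-minus (f ∘ +_) (g ∘ +_) (suc B) ⟩
    ∑ (suc B) (f ∘ +_) - ∑ (suc B) (g ∘ +_)
      ≡⟨ cong₂ _-_ (trans (restrict f Bf (ℕP.m≤m⊔n Bf Bg) vanish-f) value-f)
                   (trans (restrict g Bg (ℕP.m≤n⊔m Bf Bg) vanish-g) value-g) ⟩
    a - b
      ∎

module DivisionBy (n : ℕ) .{{_ : NonZero n}} where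

  N : ℤ
  N = + n

  instance
    N-positive : ℤ.Positive N
    N-positive = ℤ.positive (+<+ (ℕ.>-nonZero⁻¹ n))

  ⌊_⌋ : ℤ → ℤ
  ⌊ a ⌋ = a /ℕ n

  ⌈_⌉ : ℤ → ℤ
  ⌈ b ⌉ = ceilDiv b n

  ⌊⌋*N≤ : ∀ a → ⌊ a ⌋ * N ≤ a
  ⌊⌋*N≤ a = DM.[n/ℕd]*d≤n a n

  <[1+⌊⌋]*N : ∀ a → a < (1ℤ + ⌊ a ⌋) * N
  <[1+⌊⌋]*N a = DM.n<s[n/ℕd]*d a n

  *N≤⇒≤⌊⌋ : ∀ {q a} → q * N ≤ a → q ≤ ⌊ a ⌋
  *N≤⇒≤⌊⌋ {q} {a} qN≤a = <1+⇒≤ (ℤP.*-cancelʳ-<-nonNeg N (ℤP.≤-<-trans qN≤a (<[1+⌊⌋]*N a)))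

  <*N⇒⌊⌋< : ∀ {q a} → a < q * N → ⌊ a ⌋ < q
  <*N⇒⌊⌋< {q} {a} a<qN = ℤP.*-cancelʳ-<-nonNeg N (ℤP.≤-<-trans (⌊⌋*N≤ a) a<qN)

  ⌊⌋-unique : ∀ {q a} → q * N ≤ a → a < (1ℤ + q) * N → ⌊ a ⌋ ≡ q
  ⌊⌋-unique qN≤a a<[1+q]N = ℤP.≤-antisym (<1+⇒≤ (<*N⇒⌊⌋< a<[1+q]N)) (*N≤⇒≤⌊⌋ qN≤a)

  ⌊+N*⌋ : ∀ a w → ⌊ a + N * w ⌋ ≡ ⌊ a ⌋ + w
  ⌊+N*⌋ a w = ⌊⌋-unique
    (subst (_≤ a + N * w) (sym (lower ⌊ a ⌋ w N)) (ℤP.+-monoˡ-≤ (N * w) (⌊⌋*N≤ a)))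
    (subst (a + N * w <_) (sym (upper ⌊ a ⌋ w N)) (ℤP.+-monoˡ-< (N * w) (<[1+⌊⌋]*N a)))
    where
    lower : ∀ q w N → (q + w) * N ≡ q * N + N * w
    lower = solve-∀
    upper : ∀ q w N → (1ℤ + (q + w)) * N ≡ (1ℤ + q) * N + N * w
    upper = solve-∀

  ⌊⌋-nonNeg : ∀ {a} → 0ℤ ≤ a → 0ℤ ≤ ⌊ a ⌋
  ⌊⌋-nonNeg {a} = DM.0≤n⇒0≤n/ℕd a n

  ⌊⌋-neg : ∀ {a} → a < 0ℤ → ⌊ a ⌋ < 0ℤ
  ⌊⌋-neg a<0 = <*N⇒⌊⌋< a<0

  ⌊⌋-nonPos : ∀ {a} → a ≤ 0ℤ → ⌊ a ⌋ ≤ 0ℤ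
  ⌊⌋-nonPos {a} a≤0 = ℤP.*-cancelʳ-≤-pos ⌊ a ⌋ 0ℤ N (ℤP.≤-trans (⌊⌋*N≤ a) a≤0)

  ⌊0⌋ : ⌊ 0ℤ ⌋ ≡ 0ℤ
  ⌊0⌋ = ⌊⌋-unique ℤP.≤-refl (subst (0ℤ <_) (sym (ℤP.*-identityˡ N)) (ℤP.positive⁻¹ N))

  ≤N*⌈⌉ : ∀ b → b ≤ N * ⌈ b ⌉
  ≤N*⌈⌉ b = subst₂ _≤_ (ℤP.neg-involutive b) (flip ⌊ - b ⌋ N) (ℤP.neg-mono-≤ (⌊⌋*N≤ (- b)))
    where
    flip : ∀ q N → - (q * N) ≡ N * - q
    flip = solve-∀

  ⌈+N*⌉ : ∀ b w → ⌈ b + N * w ⌉ ≡ ⌈ b ⌉ + w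
  ⌈+N*⌉ b w = begin
    - ⌊ - (b + N * w) ⌋    ≡⟨ cong (-_ ∘ ⌊_⌋) (negate b N w) ⟩
    - ⌊ - b + N * - w ⌋    ≡⟨ cong -_ (⌊+N*⌋ (- b) (- w)) ⟩
    - (⌊ - b ⌋ + - w)      ≡⟨ negate′ ⌊ - b ⌋ w ⟩
    ⌈ b ⌉ + w              ∎
    where
    open ≡-Reasoning
    negate : ∀ b N w → - (b + N * w) ≡ - b + N * - w
    negate = solve-∀
    negate′ : ∀ q w → - (q + - w) ≡ - q + w
    negate′ = solve-∀

  ⌈0⌉ : ⌈ 0ℤ ⌉ ≡ 0ℤ
  ⌈0⌉ = cong -_ ⌊0⌋

  ⌈⌉≤⇒≤N* : ∀ {b x} → ⌈ b ⌉ ≤ x → b ≤ N * x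
  ⌈⌉≤⇒≤N* {b} ⌈b⌉≤x = ℤP.≤-trans (≤N*⌈⌉ b) (ℤP.*-monoˡ-≤-nonNeg N ⌈b⌉≤x)

  ≤N*⇒⌈⌉≤ : ∀ {b x} → b ≤ N * x → ⌈ b ⌉ ≤ x
  ≤N*⇒⌈⌉≤ {b} {x} b≤Nx = subst (⌈ b ⌉ ≤_) (ℤP.neg-involutive x)
    (ℤP.neg-mono-≤ (*N≤⇒≤⌊⌋ (subst (_≤ - b) (flip x N) (ℤP.neg-mono-≤ b≤Nx))))
    where
    flip : ∀ x N → - (N * x) ≡ - x * N
    flip = solve-∀

-- Backward differences

∇ : (ℕ → ℤ) → ℕ → ℤ
∇ f zero    = f zero
∇ f (suc m) = f (suc m) - f m

∇^ : ℕ → (ℕ → ℤ) → ℕ → ℤ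
∇^ zero    f = f
∇^ (suc D) f = ∇ (∇^ D f)

∇-cong : ∀ {f g : ℕ → ℤ} → (∀ m → f m ≡ g m) → ∀ m → ∇ f m ≡ ∇ g m
∇-cong f≗g zero    = f≗g zero
∇-cong f≗g (suc m) = cong₂ _-_ (f≗g (suc m)) (f≗g m)

∇^-cong : ∀ D {f g : ℕ → ℤ} → (∀ m → f m ≡ g m) → ∀ m → ∇^ D f m ≡ ∇^ D g m
∇^-cong zero    f≗g = f≗g
∇^-cong (suc D) f≗g = ∇-cong (∇^-cong D f≗g)

∇^-suc : ∀ D f m → ∇^ (suc D) f m ≡ ∇^ D (∇ f) m
∇^-suc zero    f m = refl
∇^-suc (suc D) f m = ∇-cong (∇^-suc D f) m

∇-∑ : ∀ (g : ℕ → ℕ → ℤ) L m → ∇ (λ t → ∑[ j < L ] g j t) m ≡ ∑[ j < L ] ∇ (g j) m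
∇-∑ g L zero    = refl
∇-∑ g L (suc m) = sym (∑-minus (λ j → g j (suc m)) (λ j → g j m) L)

∇^-∑ : ∀ D (g : ℕ → ℕ → ℤ) L m → ∇^ D (λ t → ∑[ j < L ] g j t) m ≡ ∑[ j < L ] ∇^ D (g j) m
∇^-∑ zero    g L m = refl
∇^-∑ (suc D) g L m = trans (∇-cong (∇^-∑ D g L) m) (∇-∑ (λ j → ∇^ D (g j)) L m)

sign : ℕ → ℤ
sign j = (- 1ℤ) ℤ.^ j

sign-suc : ∀ j → sign (suc j) ≡ - sign j
sign-suc j = ℤP.-1*i≡-i (sign j)

sign-periodic : ∀ j → sign j ≡ sign (suc (suc j))
sign-periodic j = sym (trans (sign-suc (suc j)) (trans (cong -_ (sign-suc j)) (ℤP.neg-involutive (sign j))))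

binomialDifference : ℕ → (ℕ → ℤ) → ℕ → ℤ
binomialDifference D f m = ∑[ j < suc m ] (sign j * + (D C j) * f (m ∸ j))

binomialDifference-zero : ∀ f m → binomialDifference 0 f m ≡ f m
binomialDifference-zero f m =
  trans (cong₂ _+_ (ℤP.*-identityˡ (f m)) (∑-zero m (λ i _ → vanish i))) (ℤP.+-identityʳ (f m))
  where
  vanish : ∀ i → sign (suc i) * + 0 * f (m ∸ suc i) ≡ 0ℤ
  vanish i = trans (cong (_* f (m ∸ suc i)) (ℤP.*-zeroʳ (sign (suc i)))) (ℤP.*-zeroˡ (f (m ∸ suc i)))

-- Pascal's rule splits each term of the (D+1)-st sum into terms of the D-th sums at m+1 and m.
binomialDifference-suc : ∀ D f m → binomialDifference (suc D) f m ≡ ∇ (binomialDifference D f) m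
binomialDifference-suc D f zero    = refl
binomialDifference-suc D f (suc m) = begin
  f₀ + (∑[ i < suc m ] sign (suc i) * + (suc D C suc i) * f (m ∸ i))
    ≡⟨ cong (_+_ f₀) (∑-cong (suc m) (λ i _ → pascal i)) ⟩
  f₀ + (∑[ i < suc m ] (upper i - lower i))
    ≡⟨ cong (_+_ f₀) (∑-minus upper lower (suc m)) ⟩
  f₀ + (∑ (suc m) upper - ∑ (suc m) lower)
    ≡⟨ regroup f₀ (∑ (suc m) upper) (∑ (suc m) lower) ⟩
  (f₀ + ∑ (suc m) upper) - binomialDifference D f m
    ∎
  where
  open ≡-Reasoning
  f₀ : ℤ
  f₀ = 1ℤ * + 1 * f (suc m)
  upper lower : ℕ → ℤ
  upper i = sign (suc i) * + (D C suc i) * f (m ∸ i)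
  lower i = sign i * + (D C i) * f (m ∸ i)
  regroup : ∀ x a b → x + (a - b) ≡ (x + a) - b
  regroup = solve-∀
  split : ∀ s a b y → (- s) * (a + b) * y ≡ (- s) * b * y - s * a * y
  split = solve-∀
  pascal : ∀ i → sign (suc i) * + (suc D C suc i) * f (m ∸ i) ≡ upper i - lower i
  pascal i = begin
    sign (suc i) * + (suc D C suc i) * f (m ∸ i)
      ≡⟨ cong₂ (λ s c → s * + c * f (m ∸ i)) (sign-suc i) (sym (nCk+nC[k+1]≡[n+1]C[k+1] D i)) ⟩
    - sign i * + (D C i ℕ.+ D C suc i) * f (m ∸ i)
      ≡⟨ cong (λ c → - sign i * c * f (m ∸ i)) (ℤP.pos-+ (D C i) (D C suc i)) ⟩
    - sign i * (+ (D C i) + + (D C suc i)) * f (m ∸ i)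
      ≡⟨ split (sign i) (+ (D C i)) (+ (D C suc i)) (f (m ∸ i)) ⟩
    - sign i * + (D C suc i) * f (m ∸ i) - lower i
      ≡⟨ cong (λ s → s * + (D C suc i) * f (m ∸ i) - lower i) (sym (sign-suc i)) ⟩
    upper i - lower i
      ∎

binomialDifference≡∇^ : ∀ D f m → binomialDifference D f m ≡ ∇^ D f m
binomialDifference≡∇^ zero    f m = binomialDifference-zero f m
binomialDifference≡∇^ (suc D) f m =
  trans (binomialDifference-suc D f m) (∇-cong (binomialDifference≡∇^ D f) m)

hstarℕ≡binomialDifference : ∀ {k} (p : Vec ℤ k) N m →
  hstarℕ p N m ≡ binomialDifference (suc (suc k)) (ehrhartSeries p N) m
hstarℕ≡binomialDifference {k} p N m = termwise
  where
  term : ℕ → ℤ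
  term j = sign j * + (suc (suc k) C j) * ehrhartSeries p N (m ∸ j)
  -- The sign in Defs.hstarℕ is local to its where block and cannot be named here: the left-hand
  -- sides below are inferred from the use in termwise, and generalising the other two factors of
  -- each term lets the sign reduce by matching on j.
  signed-term : ∀ j → _ ≡ term j
  termwise : hstarℕ p N m ≡ binomialDifference (suc (suc k)) (ehrhartSeries p N) m
  termwise = cong (_+_ (term 0))
    (trans (cong sumL (LP.map-cong signed-term (applyUpTo suc m))) (sumL-applyUpTo term suc m))
  signed : ∀ j (c : ℕ) (y : ℤ) → _ ≡ sign j * + c * y
  signed-term j with suc (suc k) C j | ehrhartSeries p N (m ∸ j)
  ... | c | y = signed j c y
  signed zero          c y = refl
  signed (suc zero)    c y = refl
  signed (suc (suc j)) c y = trans (signed j c y) (cong (λ s → s * + c * y) (sign-periodic j))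

-- Lattice points of dilated standard simplices

simplexCountℕ : ℕ → ℕ → ℤ
simplexCountℕ zero    r = 1ℤ
simplexCountℕ (suc k) r = ∑[ z < suc r ] simplexCountℕ k (r ∸ z)

-- #{z ∈ ℕᵏ : z₁ + ⋯ + zₖ ≤ R} = C(R + k, k), and 0 for R < 0.
simplexCount : ℕ → ℤ → ℤ
simplexCount k (+ r)    = simplexCountℕ k r
simplexCount k -[1+ _ ] = 0ℤ

simplexCount-neg : ∀ k {R} → R < 0ℤ → simplexCount k R ≡ 0ℤ
simplexCount-neg k { -[1+ _ ]} _        = refl
simplexCount-neg k {+ _}       (+<+ ())

simplexCount-pascal : ∀ k R → simplexCount (suc k) R ≡ simplexCount k R + simplexCount (suc k) (R - 1ℤ)
simplexCount-pascal k -[1+ r ]  = refl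
simplexCount-pascal k (+ zero)  = refl
simplexCount-pascal k (+ suc r) = refl

simplexCount-origin : ∀ k → simplexCount k 0ℤ ≡ 1ℤ
simplexCount-origin zero    = refl
simplexCount-origin (suc k) = trans (ℤP.+-identityʳ _) (simplexCount-origin k)

∑-simplexCount : ∀ k L R → R < + L → ∑[ s < L ] simplexCount k (R - + s) ≡ simplexCount (suc k) R
∑-simplexCount k zero    R R<0 = sym (simplexCount-neg (suc k) R<0)
∑-simplexCount k (suc L) R R<1+L = begin
  simplexCount k (R - + 0) + (∑[ s < L ] simplexCount k (R - + suc s))
    ≡⟨ cong₂ (λ a b → simplexCount k a + b) (ℤP.+-identityʳ R) (∑-cong L (λ s _ → cong (simplexCount k) (shift s))) ⟩
  simplexCount k R + (∑[ s < L ] simplexCount k (R - 1ℤ - + s))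
    ≡⟨ cong (_+_ (simplexCount k R)) (∑-simplexCount k L (R - 1ℤ) R-1<L) ⟩
  simplexCount k R + simplexCount (suc k) (R - 1ℤ)
    ≡⟨ sym (simplexCount-pascal k R) ⟩
  simplexCount (suc k) R
    ∎
  where
  open ≡-Reasoning
  rearrange : ∀ R s → R - (1ℤ + s) ≡ R - 1ℤ - s
  rearrange = solve-∀
  shift : ∀ s → R - + suc s ≡ R - 1ℤ - + s
  shift s = trans (cong (_-_ R) (ℤP.pos-+ 1 s)) (rearrange R (+ s))
  R-1<L : R - 1ℤ < + L
  R-1<L = ℤP.<-≤-trans (i-1<i R) (<1+⇒≤ R<1+L)

∇-simplexCount : ∀ k {e} → e ≤ 0ℤ → ∀ m →
  ∇ (λ t → simplexCount (suc k) (+ t + e)) m ≡ simplexCount k (+ m + e)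
∇-simplexCount k {e} e≤0 zero = begin
  simplexCount (suc k) (0ℤ + e)
    ≡⟨ simplexCount-pascal k (0ℤ + e) ⟩
  simplexCount k (0ℤ + e) + simplexCount (suc k) (0ℤ + e - 1ℤ)
    ≡⟨ cong (_+_ (simplexCount k (0ℤ + e))) (simplexCount-neg (suc k) e-1<0) ⟩
  simplexCount k (0ℤ + e) + 0ℤ
    ≡⟨ ℤP.+-identityʳ _ ⟩
  simplexCount k (0ℤ + e)
    ∎
  where
  open ≡-Reasoning
  e-1<0 : 0ℤ + e - 1ℤ < 0ℤ
  e-1<0 = ℤP.<-≤-trans (i-1<i (0ℤ + e)) (subst (_≤ 0ℤ) (sym (ℤP.+-identityˡ e)) e≤0)
∇-simplexCount k {e} e≤0 (suc m) = begin
  simplexCount (suc k) (+ suc m + e) - simplexCount (suc k) (+ m + e)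
    ≡⟨ cong (_- simplexCount (suc k) (+ m + e)) (simplexCount-pascal k (+ suc m + e)) ⟩
  simplexCount k (+ suc m + e) + simplexCount (suc k) (+ suc m + e - 1ℤ) - simplexCount (suc k) (+ m + e)
    ≡⟨ cong (λ R → simplexCount k (+ suc m + e) + simplexCount (suc k) R - simplexCount (suc k) (+ m + e)) step-back ⟩
  simplexCount k (+ suc m + e) + simplexCount (suc k) (+ m + e) - simplexCount (suc k) (+ m + e)
    ≡⟨ cancel (simplexCount k (+ suc m + e)) (simplexCount (suc k) (+ m + e)) ⟩
  simplexCount k (+ suc m + e)
    ∎
  where
  open ≡-Reasoning
  cancel : ∀ a b → a + b - b ≡ a
  cancel = solve-∀
  rearrange : ∀ m e → 1ℤ + m + e - 1ℤ ≡ m + e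
  rearrange = solve-∀
  step-back : + suc m + e - 1ℤ ≡ + m + e
  step-back = rearrange (+ m) e

simplexCount-zero-nonPos : ∀ {R} → R ≤ 0ℤ → simplexCount 0 R ≡ δ R 0ℤ
simplexCount-zero-nonPos {+ zero}    _          = refl
simplexCount-zero-nonPos { -[1+ _ ]} _          = refl
simplexCount-zero-nonPos {+ suc _}   (+≤+ ())

simplexCount-zero-step : ∀ R → simplexCount 0 (1ℤ + R) - simplexCount 0 R ≡ δ (1ℤ + R) 0ℤ
simplexCount-zero-step (+ _)            = refl
simplexCount-zero-step -[1+ zero ]      = refl
simplexCount-zero-step -[1+ suc _ ]     = refl

∇-simplexCount-zero : ∀ {e} → e ≤ 0ℤ → ∀ m → ∇ (λ t → simplexCount 0 (+ t + e)) m ≡ δ (+ m + e) 0ℤ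
∇-simplexCount-zero {e} e≤0 zero    = simplexCount-zero-nonPos (subst (_≤ 0ℤ) (sym (ℤP.+-identityˡ e)) e≤0)
∇-simplexCount-zero {e} e≤0 (suc m) = begin
  simplexCount 0 (+ suc m + e) - simplexCount 0 (+ m + e)
    ≡⟨ cong (λ R → simplexCount 0 R - simplexCount 0 (+ m + e)) (ℤP.+-assoc 1ℤ (+ m) e) ⟩
  simplexCount 0 (1ℤ + (+ m + e)) - simplexCount 0 (+ m + e)
    ≡⟨ simplexCount-zero-step (+ m + e) ⟩
  δ (1ℤ + (+ m + e)) 0ℤ
    ≡⟨ cong (λ R → δ R 0ℤ) (sym (ℤP.+-assoc 1ℤ (+ m) e)) ⟩
  δ (+ suc m + e) 0ℤ
    ∎
  where open ≡-Reasoning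

∇^-simplexCount : ∀ k {e} → e ≤ 0ℤ → ∀ m → ∇^ (suc k) (λ t → simplexCount k (+ t + e)) m ≡ δ (+ m + e) 0ℤ
∇^-simplexCount zero    e≤0 m = ∇-simplexCount-zero e≤0 m
∇^-simplexCount (suc k) {e} e≤0 m = trans (∇^-suc (suc k) (λ t → simplexCount (suc k) (+ t + e)) m)
  (trans (∇^-cong (suc k) (∇-simplexCount k e≤0) m) (∇^-simplexCount k e≤0 m))

-- #{z ∈ ℤ^{k+1} : z₀ = x, z₀ ≥ c, z₁, …, zₖ ≥ 0, (z₀ − c) + z₁ + ⋯ + zₖ ≤ R}
firstCoordinateCount : ℕ → ℤ → ℤ → ℤ → ℤ
firstCoordinateCount k c R x = if does (c ℤP.≤? x) then simplexCount k (R - (x - c)) else 0ℤ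

firstCoordinateCount-below : ∀ k c R {x} → x < c → firstCoordinateCount k c R x ≡ 0ℤ
firstCoordinateCount-below k c R {x} x<c with c ℤP.≤? x
... | yes c≤x = contradiction c≤x (ℤP.<⇒≱ x<c)
... | no  _   = refl

firstCoordinateCount-above : ∀ k c R z → firstCoordinateCount k c R (c + + z) ≡ simplexCount k (R - + z)
firstCoordinateCount-above k c R z with c ℤP.≤? c + + z
... | yes _    = cong (λ w → simplexCount k (R - w)) (cancel c (+ z))
  where
  cancel : ∀ c z → c + z - c ≡ z
  cancel = solve-∀
... | no  c≰x = contradiction (ℤP.i≤i+j c (+ z)) c≰x

firstCoordinateCount-neg : ∀ k c {R} → R < 0ℤ → ∀ x → firstCoordinateCount k c R x ≡ 0ℤ
firstCoordinateCount-neg k c {R} R<0 x with c ℤP.≤? x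
... | yes c≤x = simplexCount-neg k
  (ℤP.≤-<-trans (ℤP.i≤j⇒i-k≤j (x - c) {{ℤ.nonNegative (ℤP.i≤j⇒0≤j-i c≤x)}} ℤP.≤-refl) R<0)
... | no  _   = refl

∑-firstCoordinateCount : ∀ k c R s L → R < + L →
  ∑[ i < s ℕ.+ L ] firstCoordinateCount k c R (c - + s + + i) ≡ simplexCount (suc k) R
∑-firstCoordinateCount k c R s L R<L = begin
  ∑[ i < s ℕ.+ L ] f i                                ≡⟨ ∑-split f s L ⟩
  ∑ s f + (∑[ z < L ] f (s ℕ.+ z))                    ≡⟨ cong₂ _+_ (∑-zero s below) (∑-cong L (λ z _ → above z)) ⟩
  0ℤ + (∑[ z < L ] simplexCount k (R - + z))          ≡⟨ ℤP.+-identityˡ _ ⟩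
  ∑[ z < L ] simplexCount k (R - + z)                 ≡⟨ ∑-simplexCount k L R R<L ⟩
  simplexCount (suc k) R                              ∎
  where
  open ≡-Reasoning
  f : ℕ → ℤ
  f i = firstCoordinateCount k c R (c - + s + + i)
  below-shift : ∀ c s i → c - (c - s + i) - 1ℤ ≡ s - (1ℤ + i)
  below-shift = solve-∀
  below : ∀ i → i ℕ.< s → f i ≡ 0ℤ
  below i i<s = firstCoordinateCount-below k c R
    (<-witness (+ s - + suc i) (below-shift c (+ s) (+ i)) (ℤP.i≤j⇒0≤j-i (+≤+ i<s)))
  above-shift : ∀ c s z → c - s + (s + z) ≡ c + z
  above-shift = solve-∀
  above : ∀ z → f (s ℕ.+ z) ≡ simplexCount k (R - + z)
  above z = trans (cong (firstCoordinateCount k c R) (above-shift c (+ s) (+ z)))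
                  (firstCoordinateCount-above k c R z)

∑-box-firstCoordinateCount : ∀ k B c R → (0ℤ ≤ R → - + B ≤ c × c + R ≤ + B) →
  ∑[ i < suc (B ℕ.+ B) ] firstCoordinateCount k c R (+ i - + B) ≡ simplexCount (suc k) R
∑-box-firstCoordinateCount k B c R window with 0ℤ ℤP.≤? R
... | no R≱0 = trans (∑-zero (suc (B ℕ.+ B)) (λ i _ → firstCoordinateCount-neg k c R<0 (+ i - + B)))
                     (sym (simplexCount-neg (suc k) R<0))
  where
  R<0 : R < 0ℤ
  R<0 = ℤP.≰⇒> R≱0
... | yes 0≤R = begin
  ∑[ i < suc (B ℕ.+ B) ] g (+ i - + B)   ≡⟨ cong (λ l → ∑[ i < l ] g (+ i - + B)) (sym s+L≡1+2B) ⟩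
  ∑[ i < s ℕ.+ L ] g (+ i - + B)         ≡⟨ ∑-cong (s ℕ.+ L) (λ i _ → cong g (reindex i)) ⟩
  ∑[ i < s ℕ.+ L ] g (c - + s + + i)     ≡⟨ ∑-firstCoordinateCount k c R s L R<L ⟩
  simplexCount (suc k) R                 ∎
  where
  open ≡-Reasoning
  g : ℤ → ℤ
  g = firstCoordinateCount k c R
  -B≤c : - + B ≤ c
  -B≤c = proj₁ (window 0≤R)
  c+R≤B : c + R ≤ + B
  c+R≤B = proj₂ (window 0≤R)
  0≤B-[c+R] : 0ℤ ≤ + B - (c + R)
  0≤B-[c+R] = ℤP.i≤j⇒0≤j-i c+R≤B
  s L : ℕ
  s = ∣ c + + B ∣
  L = ∣ + B - (c + R) + (R + 1ℤ) ∣
  +s≡ : + s ≡ c + + B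
  +s≡ = ℤP.0≤i⇒+∣i∣≡i (subst (0ℤ ≤_) (minus-neg c (+ B)) (ℤP.i≤j⇒0≤j-i -B≤c))
    where
    minus-neg : ∀ c B → c - - B ≡ c + B
    minus-neg = solve-∀
  +L≡ : + L ≡ + B - (c + R) + (R + 1ℤ)
  +L≡ = ℤP.0≤i⇒+∣i∣≡i (ℤP.+-mono-≤ 0≤B-[c+R] (ℤP.+-mono-≤ 0≤R (+≤+ z≤n)))
  total : ∀ c B R → c + B + (B - (c + R) + (R + 1ℤ)) ≡ 1ℤ + (B + B)
  total = solve-∀
  s+L≡1+2B : s ℕ.+ L ≡ suc (B ℕ.+ B)
  s+L≡1+2B = ℤP.+-injective (trans (cong₂ _+_ +s≡ +L≡) (total c (+ B) R))
  reindex : ∀ i → + i - + B ≡ c - + s + + i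
  reindex i = trans (shift c (+ B) (+ i)) (cong (λ t → c - t + + i) (sym +s≡))
    where
    shift : ∀ c B i → i - B ≡ c - (c + B) + i
    shift = solve-∀
  R<L : R < + L
  R<L = <-witness (+ B - (c + R)) (trans (cong (λ l → l - R - 1ℤ) +L≡) (gap (+ B) c R)) 0≤B-[c+R]
    where
    gap : ∀ B c R → B - (c + R) + (R + 1ℤ) - R - 1ℤ ≡ B - (c + R)
    gap = solve-∀

-- Slices of tΔ(0,p)

isNonNeg : ℤ → Bool
isNonNeg a = does (0ℤ ℤP.≤? a)

isNonNeg-sound : ∀ {a} → isNonNeg a ≡ true → 0ℤ ≤ a
isNonNeg-sound {a} e with 0ℤ ℤP.≤? a
... | yes 0≤a = 0≤a
isNonNeg-sound {a} () | no _

∣∣≤⇒bounds : ∀ {q M} → ∣ q ∣ ℕ.≤ M → - + M ≤ q × q ≤ + M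
∣∣≤⇒bounds {+ _}      q≤M = ℤP.≤-trans (ℤP.neg-mono-≤ (+≤+ z≤n)) (+≤+ z≤n) , +≤+ q≤M
∣∣≤⇒bounds { -[1+ _ ]} q≤M = ℤP.neg-mono-≤ (+≤+ q≤M) , ℤ.-≤+

absSum : ∀ {k} → Vec ℤ k → ℕ
absSum = V.foldr (λ _ → ℕ) (λ a b → ∣ a ∣ ℕ.+ b) zero

∣∣≤absSum : ∀ {k} (ps : Vec ℤ k) → All (λ q → ∣ q ∣ ℕ.≤ absSum ps) ps
∣∣≤absSum []       = []
∣∣≤absSum (p ∷ ps) = ℕP.m≤m+n ∣ p ∣ (absSum ps)
                   ∷ All.map (λ q≤ → ℕP.≤-trans q≤ (ℕP.m≤n+m (absSum ps) ∣ p ∣)) (∣∣≤absSum ps)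

InBox : ℕ → ∀ {k} → Vec ℤ k → Set
InBox B = All (λ x → - + B ≤ x × x ≤ + B)

module Slice (n : ℕ) .{{_ : NonZero n}} (y : ℤ) where
  open DivisionBy n

  -- n times the barycentric coordinate λᵢ of a point with i-th coordinate x and last coordinate y
  μ : ℤ → ℤ → ℤ
  μ p x = N * x - p * y

  inSlice : ∀ {k} → Vec ℤ k → ℤ → Vec ℤ k → Bool
  inSlice []       a []       = isNonNeg a
  inSlice (p ∷ ps) a (x ∷ xs) = isNonNeg (μ p x) ∧ inSlice ps (a - μ p x) xs

  -- the least nonnegative value of μ p, attained at x = ⌈ p y / n ⌉
  ρ : ℤ → ℤ
  ρ p = N * ⌈ p * y ⌉ - p * y

  ρΣ : ∀ {k} → Vec ℤ k → ℤ
  ρΣ []       = 0ℤ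
  ρΣ (p ∷ ps) = ρ p + ρΣ ps

  corner : ∀ {k} → Vec ℤ k → Vec ℤ k
  corner = V.map (λ p → ⌈ p * y ⌉)

  ρ-nonNeg : ∀ p → 0ℤ ≤ ρ p
  ρ-nonNeg p = ℤP.i≤j⇒0≤j-i (≤N*⌈⌉ (p * y))

  ρΣ-nonNeg : ∀ {k} (ps : Vec ℤ k) → 0ℤ ≤ ρΣ ps
  ρΣ-nonNeg []       = ℤP.≤-refl
  ρΣ-nonNeg (p ∷ ps) = ℤP.+-mono-≤ (ρ-nonNeg p) (ρΣ-nonNeg ps)

  μ-nonNeg⇒⌈⌉≤ : ∀ p x → 0ℤ ≤ μ p x → ⌈ p * y ⌉ ≤ x
  μ-nonNeg⇒⌈⌉≤ p x 0≤μ = ≤N*⇒⌈⌉≤ (ℤP.0≤i-j⇒j≤i 0≤μ)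

  ⌈⌉≤⇒μ-nonNeg : ∀ p x → ⌈ p * y ⌉ ≤ x → 0ℤ ≤ μ p x
  ⌈⌉≤⇒μ-nonNeg p x c≤x = ℤP.i≤j⇒0≤j-i (⌈⌉≤⇒≤N* c≤x)

  inSlice-∷ : ∀ {k} p (ps : Vec ℤ k) a x xs → 0ℤ ≤ μ p x → inSlice ps (a - μ p x) xs ≡ true →
              inSlice (p ∷ ps) a (x ∷ xs) ≡ true
  inSlice-∷ p ps a x xs 0≤μ rest = cong₂ _∧_ (dec-true (0ℤ ℤP.≤? μ p x) 0≤μ) rest

  corner-inSlice : ∀ {k} (ps : Vec ℤ k) {b} → ρΣ ps ≤ b → inSlice ps b (corner ps) ≡ true
  corner-inSlice []       {b} 0≤b  = dec-true (0ℤ ℤP.≤? b) 0≤b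
  corner-inSlice (p ∷ ps) {b} ρΣ≤b = inSlice-∷ p ps b ⌈ p * y ⌉ (corner ps) (ρ-nonNeg p)
    (corner-inSlice ps (≤-witness (b - (ρ p + ρΣ ps)) (regroup b (ρ p) (ρΣ ps)) (ℤP.i≤j⇒0≤j-i ρΣ≤b)))
    where
    regroup : ∀ b r s → b - r - s ≡ b - (r + s)
    regroup = solve-∀

  count : ℕ → ∀ {k} → Vec ℤ k → ℤ → ℕ
  count B {k} ps a = countB (inSlice ps a) (allVecs k (range B))

  indicator≡simplexCount-zero : ∀ a → + (if isNonNeg a then 1 else 0) ≡ simplexCount 0 ⌊ a ⌋
  indicator≡simplexCount-zero a with 0ℤ ℤP.≤? a
  ... | yes 0≤a = simplexCount-zero-nonNeg (⌊⌋-nonNeg 0≤a)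
    where
    simplexCount-zero-nonNeg : ∀ {R} → 0ℤ ≤ R → 1ℤ ≡ simplexCount 0 R
    simplexCount-zero-nonNeg (+≤+ _) = refl
  ... | no  0≰a = sym (simplexCount-neg 0 (⌊⌋-neg (ℤP.≰⇒> 0≰a)))

  -- Witnessed by the points c ∷ corner ps and (c + R) ∷ corner ps of the slice.
  corners-in-box : ∀ B {k} p (ps : Vec ℤ k) a → (∀ xs → inSlice (p ∷ ps) a xs ≡ true → InBox B xs) →
    0ℤ ≤ ⌊ a - ρΣ (p ∷ ps) ⌋ → - + B ≤ ⌈ p * y ⌉ × ⌈ p * y ⌉ + ⌊ a - ρΣ (p ∷ ps) ⌋ ≤ + B
  corners-in-box B p ps a boxed 0≤R =
    proj₁ (All.head (boxed (c ∷ corner ps) lowest)) , proj₂ (All.head (boxed ((c + R) ∷ corner ps) highest))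
    where
    c a′ R : ℤ
    c = ⌈ p * y ⌉
    a′ = a - ρΣ (p ∷ ps)
    R = ⌊ a′ ⌋
    RN≤a′ : R * N ≤ a′
    RN≤a′ = ⌊⌋*N≤ a′
    0≤a′ : 0ℤ ≤ a′
    0≤a′ = ℤP.≤-trans (ℤP.*-monoʳ-≤-nonNeg N 0≤R) RN≤a′
    regroup : ∀ a r s → a - r - s ≡ a - (r + s)
    regroup = solve-∀
    lowest : inSlice (p ∷ ps) a (c ∷ corner ps) ≡ true
    lowest = inSlice-∷ p ps a c (corner ps) (ρ-nonNeg p)
      (corner-inSlice ps (≤-witness a′ (regroup a (ρ p) (ρΣ ps)) 0≤a′))
    top : ∀ a N c p y R r → a - (N * (c + R) - p * y) - r ≡ a - ((N * c - p * y) + r) - R * N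
    top = solve-∀
    highest : inSlice (p ∷ ps) a ((c + R) ∷ corner ps) ≡ true
    highest = inSlice-∷ p ps a (c + R) (corner ps)
      (⌈⌉≤⇒μ-nonNeg p (c + R) (ℤP.i≤i+j c R {{ℤ.nonNegative 0≤R}}))
      (corner-inSlice ps (≤-witness (a′ - R * N) (top a N c p y R (ρΣ ps)) (ℤP.i≤j⇒0≤j-i RN≤a′)))

  count-slice : ∀ B {k} (ps : Vec ℤ k) a → (∀ xs → inSlice ps a xs ≡ true → InBox B xs) →
                + count B ps a ≡ simplexCount k ⌊ a - ρΣ ps ⌋
  count-slice B []       a _ =
    trans (indicator≡simplexCount-zero a) (cong (simplexCount 0 ∘ ⌊_⌋) (sym (ℤP.+-identityʳ a)))
  count-slice B {suc k} (p ∷ ps) a boxed = begin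
    + count B (p ∷ ps) a
      ≡⟨ cong +_ (countB-allVecs (inSlice (p ∷ ps) a) (range B)) ⟩
    + sum (L.map (λ x → countB (inSlice (p ∷ ps) a ∘ (x ∷_)) (allVecs k (range B))) (range B))
      ≡⟨ sum-range _ B ⟩
    ∑[ i < suc (B ℕ.+ B) ] + countB (inSlice (p ∷ ps) a ∘ ((+ i - + B) ∷_)) (allVecs k (range B))
      ≡⟨ ∑-cong (suc (B ℕ.+ B)) (λ i _ → fibre (+ i - + B)) ⟩
    ∑[ i < suc (B ℕ.+ B) ] firstCoordinateCount k c R (+ i - + B)
      ≡⟨ ∑-box-firstCoordinateCount k B c R (corners-in-box B p ps a boxed) ⟩
    simplexCount (suc k) R
      ∎
    where
    open ≡-Reasoning
    c a′ R : ℤ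
    c = ⌈ p * y ⌉
    a′ = a - ρΣ (p ∷ ps)
    R = ⌊ a′ ⌋
    shift : ∀ a N x p y c r → a - (N * x - p * y) - r ≡ a - ((N * c - p * y) + r) + N * - (x - c)
    shift = solve-∀
    floor-shift : ∀ x → ⌊ a - μ p x - ρΣ ps ⌋ ≡ R - (x - c)
    floor-shift x = trans (cong ⌊_⌋ (shift a N x p y c (ρΣ ps))) (⌊+N*⌋ a′ (- (x - c)))

    fibre-if : ∀ x → + (if isNonNeg (μ p x) then count B ps (a - μ p x) else 0) ≡ firstCoordinateCount k c R x
    fibre-if x with 0ℤ ℤP.≤? μ p x | c ℤP.≤? x
    ... | yes 0≤μ | yes _   = trans
      (count-slice B ps (a - μ p x) (λ xs → All.tail ∘ boxed (x ∷ xs) ∘ inSlice-∷ p ps a x xs 0≤μ))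
      (cong (simplexCount k) (floor-shift x))
    ... | yes 0≤μ | no  c≰x = contradiction (μ-nonNeg⇒⌈⌉≤ p x 0≤μ) c≰x
    ... | no  0≰μ | yes c≤x = contradiction (⌈⌉≤⇒μ-nonNeg p x c≤x) 0≰μ
    ... | no  _   | no  _   = refl

    fibre : ∀ x → + countB (inSlice (p ∷ ps) a ∘ (x ∷_)) (allVecs k (range B)) ≡ firstCoordinateCount k c R x
    fibre x = trans (cong +_ (countB-∧ (isNonNeg (μ p x)) (inSlice ps (a - μ p x)) (allVecs k (range B)))) (fibre-if x)

-- The Ehrhart function and h*-polynomial of Δ(0,p)

module Dilate (n : ℕ) .{{_ : NonZero n}} {k : ℕ} (p : Vec ℤ k) where
  open DivisionBy n
  open Slice n

  isNonNegScaled : ℤ → Bool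
  isNonNegScaled a = does (0ℤ ℤP.≤? N * a)

  isNonNegScaled≡isNonNeg : ∀ a → isNonNegScaled a ≡ isNonNeg a
  isNonNegScaled≡isNonNeg a = does-⇔ (0ℤ ℤP.≤? N * a) (0ℤ ℤP.≤? a)
    (λ 0≤Na → ℤP.*-cancelˡ-≤-pos 0ℤ a N (subst (_≤ N * a) (sym (ℤP.*-zeroʳ N)) 0≤Na))
    (λ 0≤a → subst (_≤ N * a) (ℤP.*-zeroʳ N) (ℤP.*-monoˡ-≤-nonNeg N 0≤a))

  μs : ℤ → ∀ {j} → Vec ℤ j → Vec ℤ j → Vec ℤ j
  μs y xs qs = V.zipWith (λ xi qi → N * xi - qi * y) xs qs

  allNonNegScaled : ∀ {j} → Vec ℤ j → Bool
  allNonNegScaled = V.foldr (λ _ → Bool) (λ m b → isNonNegScaled m ∧ b) true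

  inSlice≡ : ∀ y {j} (qs xs : Vec ℤ j) a →
    isNonNegScaled (a - sumV (μs y xs qs)) ∧ allNonNegScaled (μs y xs qs) ≡ inSlice y qs a xs
  inSlice≡ y []       []       a = trans (BP.∧-identityʳ _) (trans (isNonNegScaled≡isNonNeg (a - 0ℤ)) (cong isNonNeg (ℤP.+-identityʳ a)))
  inSlice≡ y (q ∷ qs) (x ∷ xs) a = begin
    isNonNegScaled (a - (μ y q x + S)) ∧ (isNonNegScaled (μ y q x) ∧ rest)
      ≡⟨ ∧-swap (isNonNegScaled (a - (μ y q x + S))) (isNonNegScaled (μ y q x)) rest ⟩
    isNonNegScaled (μ y q x) ∧ (isNonNegScaled (a - (μ y q x + S)) ∧ rest)
      ≡⟨ cong₂ (λ b a′ → b ∧ (isNonNegScaled a′ ∧ rest)) (isNonNegScaled≡isNonNeg (μ y q x)) (regroup a (μ y q x) S) ⟩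
    isNonNeg (μ y q x) ∧ (isNonNegScaled (a - μ y q x - S) ∧ rest)
      ≡⟨ cong (isNonNeg (μ y q x) ∧_) (inSlice≡ y qs xs (a - μ y q x)) ⟩
    isNonNeg (μ y q x) ∧ inSlice y qs (a - μ y q x) xs
      ∎
    where
    open ≡-Reasoning
    S : ℤ
    S = sumV (μs y xs qs)
    rest : Bool
    rest = allNonNegScaled (μs y xs qs)
    regroup : ∀ a m s → a - (m + s) ≡ a - m - s
    regroup = solve-∀

  inDilate≡ : ∀ t xs y → inDilate p N t xs y ≡ isNonNeg y ∧ inSlice y p (N * + t - y) xs
  inDilate≡ t xs y = begin
    isNonNegScaled (N * + t - S - y) ∧ (isNonNegScaled y ∧ rest)
      ≡⟨ ∧-swap (isNonNegScaled (N * + t - S - y)) (isNonNegScaled y) rest ⟩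
    isNonNegScaled y ∧ (isNonNegScaled (N * + t - S - y) ∧ rest)
      ≡⟨ cong₂ (λ b a → b ∧ (isNonNegScaled a ∧ rest)) (isNonNegScaled≡isNonNeg y) (reorder (N * + t) S y) ⟩
    isNonNeg y ∧ (isNonNegScaled (N * + t - y - S) ∧ rest)
      ≡⟨ cong (isNonNeg y ∧_) (inSlice≡ y p xs (N * + t - y)) ⟩
    isNonNeg y ∧ inSlice y p (N * + t - y) xs
      ∎
    where
    open ≡-Reasoning
    S : ℤ
    S = sumV (μs y xs p)
    rest : Bool
    rest = allNonNegScaled (μs y xs p)
    reorder : ∀ a s y → a - s - y ≡ a - y - s
    reorder = solve-∀

  inSlice-budget : ∀ y {j} (qs xs : Vec ℤ j) a → inSlice y qs a xs ≡ true → 0ℤ ≤ a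
  inSlice-budget y []       []       a e = isNonNeg-sound e
  inSlice-budget y (q ∷ qs) (x ∷ xs) a e = subst (0ℤ ≤_) (cancel a (μ y q x))
    (ℤP.+-mono-≤ (inSlice-budget y qs xs (a - μ y q x) (BP.∧-conicalʳ _ _ e)) (isNonNeg-sound (BP.∧-conicalˡ _ _ e)))
    where
    cancel : ∀ a m → a - m + m ≡ a
    cancel = solve-∀

  M : ℕ
  M = absSum p

  box : ℕ → ℕ
  box t = t ℕ.* boxM p N

  module _ (t : ℕ) {y : ℤ} (0≤y : 0ℤ ≤ y) (y≤Nt : y ≤ N * + t) where
    T : ℤ
    T = + t

    +box≡ : + box t ≡ T + T * N + T * + M
    +box≡ = trans (ℤP.pos-* t (suc (n ℕ.+ M)))
      (trans (cong (T *_) (trans (ℤP.pos-+ 1 (n ℕ.+ M)) (cong (_+_ 1ℤ) (ℤP.pos-+ n M)))) (expand T N (+ M)))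
      where
      expand : ∀ T N M → T * (1ℤ + (N + M)) ≡ T + T * N + T * M
      expand = solve-∀

    MT≤box : + M * T ≤ + box t
    MT≤box = ≤-witness (T + T * N) (trans (cong (_- + M * T) +box≡) (rest T N (+ M)))
      (ℤP.+-mono-≤ (+≤+ z≤n) (subst (_≤ T * N) (ℤP.*-zeroʳ T) (ℤP.*-monoˡ-≤-nonNeg T (+≤+ z≤n))))
      where
      rest : ∀ T N M → T + T * N + T * M - M * T ≡ T + T * N
      rest = solve-∀

    T+MT≤box : T + + M * T ≤ + box t
    T+MT≤box = ≤-witness (T * N) (trans (cong (_- (T + + M * T)) +box≡) (rest T N (+ M)))
      (subst (_≤ T * N) (ℤP.*-zeroʳ T) (ℤP.*-monoˡ-≤-nonNeg T (+≤+ z≤n)))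
      where
      rest : ∀ T N M → T + T * N + T * M - (T + M * T) ≡ T * N
      rest = solve-∀

    -- From 0 ≤ μ = n x − q y ≤ n t and |q y| ≤ M n t.
    coordinate-bound : ∀ {q x} → ∣ q ∣ ℕ.≤ M → 0ℤ ≤ μ y q x → μ y q x ≤ N * T → - + box t ≤ x × x ≤ + box t
    coordinate-bound {q} {x} ∣q∣≤M 0≤μ μ≤NT = lower , upper
      where
      open ℤP.≤-Reasoning
      instance
        y-nonNeg : ℤ.NonNegative y
        y-nonNeg = ℤ.nonNegative 0≤y
      recombine : ∀ N x q y → N * x ≡ (N * x - q * y) + q * y
      recombine = solve-∀
      qy≤My : q * y ≤ + M * y
      qy≤My = ℤP.*-monoʳ-≤-nonNeg y {q} {+ M} (proj₂ (∣∣≤⇒bounds ∣q∣≤M))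
      -My≤qy : - (+ M * y) ≤ q * y
      -My≤qy = subst (_≤ q * y) (sym (ℤP.neg-distribˡ-* (+ M) y)) (ℤP.*-monoʳ-≤-nonNeg y { - + M} {q} (proj₁ (∣∣≤⇒bounds ∣q∣≤M)))
      upper : x ≤ + box t
      upper = ℤP.*-cancelˡ-≤-pos x (+ box t) N (begin
        N * x                      ≡⟨ recombine N x q y ⟩
        μ y q x + q * y            ≤⟨ ℤP.+-mono-≤ μ≤NT qy≤My ⟩
        N * T + + M * y            ≤⟨ ℤP.+-monoʳ-≤ (N * T) (ℤP.*-monoˡ-≤-nonNeg (+ M) y≤Nt) ⟩
        N * T + + M * (N * T)      ≡⟨ factor N T (+ M) ⟩
        N * (T + + M * T)          ≤⟨ ℤP.*-monoˡ-≤-nonNeg N T+MT≤box ⟩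
        N * + box t                ∎)
        where
        factor : ∀ N T M → N * T + M * (N * T) ≡ N * (T + M * T)
        factor = solve-∀
      lower : - + box t ≤ x
      lower = ℤP.*-cancelˡ-≤-pos (- + box t) x N (begin
        N * - + box t              ≤⟨ ℤP.*-monoˡ-≤-nonNeg N (ℤP.neg-mono-≤ MT≤box) ⟩
        N * - (+ M * T)            ≡⟨ factor N T (+ M) ⟩
        - (+ M * (N * T))          ≤⟨ ℤP.neg-mono-≤ (ℤP.*-monoˡ-≤-nonNeg (+ M) y≤Nt) ⟩
        - (+ M * y)                ≤⟨ -My≤qy ⟩
        q * y                      ≤⟨ ℤP.i≤j+i (q * y) (μ y q x) {{ℤ.nonNegative 0≤μ}} ⟩
        μ y q x + q * y            ≡⟨ sym (recombine N x q y) ⟩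
        N * x                      ∎)
        where
        factor : ∀ N T M → N * - (M * T) ≡ - (M * (N * T))
        factor = solve-∀

    inSlice⇒InBox : ∀ {j} (qs xs : Vec ℤ j) a → All (λ q → ∣ q ∣ ℕ.≤ M) qs → a ≤ N * T →
                    inSlice y qs a xs ≡ true → InBox (box t) xs
    inSlice⇒InBox []       []       a _               _    _ = []
    inSlice⇒InBox (q ∷ qs) (x ∷ xs) a (∣q∣≤M ∷ bound) a≤NT e =
      coordinate-bound {q} {x} ∣q∣≤M 0≤μ (ℤP.≤-trans μ≤a a≤NT) ∷ inSlice⇒InBox qs xs (a - μ y q x) bound (ℤP.≤-trans a-μ≤a a≤NT) rest
      where
      rest : inSlice y qs (a - μ y q x) xs ≡ true
      rest = BP.∧-conicalʳ _ _ e
      0≤μ : 0ℤ ≤ μ y q x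
      0≤μ = isNonNeg-sound (BP.∧-conicalˡ _ _ e)
      μ≤a : μ y q x ≤ a
      μ≤a = ℤP.0≤i-j⇒j≤i (inSlice-budget y qs xs (a - μ y q x) rest)
      a-μ≤a : a - μ y q x ≤ a
      a-μ≤a = ℤP.i≤j⇒i-k≤j (μ y q x) {{ℤ.nonNegative 0≤μ}} ℤP.≤-refl

  sliceCount slice : ℕ → ℤ → ℤ
  sliceCount t y = simplexCount k ⌊ N * + t - y - ρΣ y p ⌋
  slice t y = if isNonNeg y then sliceCount t y else 0ℤ

  count-slice-of-dilate : ∀ t y → + countB (λ xs → inDilate p N t xs y) (allVecs k (range (box t))) ≡ slice t y
  count-slice-of-dilate t y = trans
    (cong +_ (trans (countB-cong (allVecs k (range (box t))) (λ xs → inDilate≡ t xs y))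
                    (countB-∧ (isNonNeg y) (inSlice y p (N * + t - y)) (allVecs k (range (box t))))))
    by-sign
    where
    a : ℤ
    a = N * + t - y
    by-sign : + (if isNonNeg y then count y (box t) p a else 0) ≡ slice t y
    by-sign with 0ℤ ℤP.≤? y
    ... | yes 0≤y = count-slice y (box t) p a (λ xs e →
          inSlice⇒InBox t 0≤y (ℤP.0≤i-j⇒j≤i (inSlice-budget y p xs a e)) p xs a (∣∣≤absSum p)
                        (ℤP.i≤j⇒i-k≤j y {{ℤ.nonNegative 0≤y}} ℤP.≤-refl) e)
    ... | no  _   = refl

  ρΣ-periodic : ∀ y w {j} (qs : Vec ℤ j) → ρΣ (y + N * w) qs ≡ ρΣ y qs
  ρΣ-periodic y w []       = refl
  ρΣ-periodic y w (q ∷ qs) = cong₂ _+_ ρ-periodic (ρΣ-periodic y w qs)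
    where
    distrib : ∀ q y N w → q * (y + N * w) ≡ q * y + N * (q * w)
    distrib = solve-∀
    cancel : ∀ N c q w y → N * (c + q * w) - q * (y + N * w) ≡ N * c - q * y
    cancel = solve-∀
    ρ-periodic : N * ⌈ q * (y + N * w) ⌉ - q * (y + N * w) ≡ N * ⌈ q * y ⌉ - q * y
    ρ-periodic = trans (cong (λ c → N * c - q * (y + N * w)) (trans (cong ⌈_⌉ (distrib q y N w)) (⌈+N*⌉ (q * y) (q * w))))
                       (cancel N ⌈ q * y ⌉ q w y)

  ρΣ-zero : ∀ {j} (qs : Vec ℤ j) → ρΣ 0ℤ qs ≡ 0ℤ
  ρΣ-zero []       = refl
  ρΣ-zero (q ∷ qs) = cong₂ _+_ ρ-zero (ρΣ-zero qs)
    where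
    ρ-zero : N * ⌈ q * 0ℤ ⌉ - q * 0ℤ ≡ 0ℤ
    ρ-zero = trans (cong (λ z → N * ⌈ z ⌉ - z) (ℤP.*-zeroʳ q))
                   (trans (cong (λ c → N * c - 0ℤ) ⌈0⌉) (cong (_+ 0ℤ) (ℤP.*-zeroʳ N)))

  -- For y = s n + j, the slice count is simplexCount k (t − s + offset j).
  offset : ℕ → ℤ
  offset j = ⌊ - + j - ρΣ (+ j) p ⌋

  offset-nonPos : ∀ j → offset j ≤ 0ℤ
  offset-nonPos j = ⌊⌋-nonPos (ℤP.i≤j⇒i-k≤j (ρΣ (+ j) p) {{ℤ.nonNegative (ρΣ-nonNeg (+ j) p)}} (ℤP.neg-mono-≤ (+≤+ {0} {j} z≤n)))

  offset-zero : offset 0 ≡ 0ℤ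
  offset-zero = trans (cong (λ r → ⌊ 0ℤ - r ⌋) (ρΣ-zero p)) ⌊0⌋

  offset-suc : ∀ j → offset (suc j) < 0ℤ
  offset-suc j = ⌊⌋-neg (ℤP.≤-<-trans (ℤP.i≤j⇒i-k≤j (ρΣ (+ suc j) p) {{ℤ.nonNegative (ρΣ-nonNeg (+ suc j) p)}} ℤP.≤-refl) ℤ.-<+)

  slice-shift : ∀ t s j → slice t (+ (s ℕ.* n ℕ.+ j)) ≡ simplexCount k (+ t + offset j - + s)
  slice-shift t s j = trans (cong (λ b → if b then sliceCount t (+ (s ℕ.* n ℕ.+ j)) else 0ℤ) (dec-true (0ℤ ℤP.≤? + (s ℕ.* n ℕ.+ j)) (+≤+ z≤n)))
                            (cong (simplexCount k) floor-eq)
    where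
    open ≡-Reasoning
    y≡ : + (s ℕ.* n ℕ.+ j) ≡ + j + N * + s
    y≡ = trans (ℤP.pos-+ (s ℕ.* n) j) (trans (cong (_+ + j) (ℤP.pos-* s n)) (swap (+ s) N (+ j)))
      where
      swap : ∀ s N j → s * N + j ≡ j + N * s
      swap = solve-∀
    regroup : ∀ N t j s r → N * t - (j + N * s) - r ≡ (- j - r) + N * (t - s)
    regroup = solve-∀
    reorder : ∀ e t s → e + (t - s) ≡ t + e - s
    reorder = solve-∀
    floor-eq : ⌊ N * + t - + (s ℕ.* n ℕ.+ j) - ρΣ (+ (s ℕ.* n ℕ.+ j)) p ⌋ ≡ + t + offset j - + s
    floor-eq = begin
      ⌊ N * + t - + (s ℕ.* n ℕ.+ j) - ρΣ (+ (s ℕ.* n ℕ.+ j)) p ⌋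
        ≡⟨ cong (λ y → ⌊ N * + t - y - ρΣ y p ⌋) y≡ ⟩
      ⌊ N * + t - (+ j + N * + s) - ρΣ (+ j + N * + s) p ⌋
        ≡⟨ cong (λ r → ⌊ N * + t - (+ j + N * + s) - r ⌋) (ρΣ-periodic (+ j) (+ s) p) ⟩
      ⌊ N * + t - (+ j + N * + s) - ρΣ (+ j) p ⌋
        ≡⟨ cong ⌊_⌋ (regroup N (+ t) (+ j) (+ s) (ρΣ (+ j) p)) ⟩
      ⌊ (- + j - ρΣ (+ j) p) + N * (+ t - + s) ⌋
        ≡⟨ ⌊+N*⌋ (- + j - ρΣ (+ j) p) (+ t - + s) ⟩
      offset j + (+ t - + s)
        ≡⟨ reorder (offset j) (+ t) (+ s) ⟩
      + t + offset j - + s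
        ∎

  ∑-column : ∀ t j → ∑[ s < suc t ] slice t (+ (s ℕ.* n ℕ.+ j)) ≡ simplexCount (suc k) (+ t + offset j)
  ∑-column t j = trans (∑-cong (suc t) (λ s _ → slice-shift t s j)) (∑-simplexCount k (suc t) (+ t + offset j) below)
    where
    below : + t + offset j < + suc t
    below = ℤP.≤-<-trans (ℤP.+-monoʳ-≤ (+ t) (offset-nonPos j)) (ℤP.≤-<-trans (ℤP.≤-reflexive (ℤP.+-identityʳ (+ t))) (+<+ ℕP.≤-refl))

  slice-neg : ∀ t {y} → y < 0ℤ → slice t y ≡ 0ℤ
  slice-neg t {y} y<0 = cong (λ b → if b then sliceCount t y else 0ℤ) (dec-false (0ℤ ℤP.≤? y) (ℤP.<⇒≱ y<0))

  slice-high : ∀ t i → suc (n ℕ.* t) ℕ.≤ i → slice t (+ i) ≡ 0ℤ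
  slice-high t i nt<i = trans (cong (λ b → if b then sliceCount t (+ i) else 0ℤ) (dec-true (0ℤ ℤP.≤? + i) (+≤+ z≤n)))
    (simplexCount-neg k (⌊⌋-neg {N * + t - + i - ρΣ (+ i) p} (<-witness (+ i - (1ℤ + N * + t) + ρΣ (+ i) p) (rearrange N (+ t) (+ i) (ρΣ (+ i) p))
      (ℤP.+-mono-≤ (ℤP.i≤j⇒0≤j-i (subst (_≤ + i) (cong (_+_ 1ℤ) (ℤP.pos-* n t)) (+≤+ nt<i))) (ρΣ-nonNeg (+ i) p)))))
    where
    rearrange : ∀ N t i r → 0ℤ - (N * t - i - r) - 1ℤ ≡ i - (1ℤ + N * t) + r
    rearrange = solve-∀

  ehrhart≡∑slices : ∀ t → + ehrhart p N t ≡ ∑[ i < suc (box t) ] slice t (+ i)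
  ehrhart≡∑slices t = begin
    + ehrhart p N t
      ≡⟨ sum-range _ B ⟩
    ∑[ i < suc (B ℕ.+ B) ] + countB (λ xs → inDilate p N t xs (+ i - + B)) (allVecs k (range B))
      ≡⟨ ∑-cong (suc (B ℕ.+ B)) (λ i _ → count-slice-of-dilate t (+ i - + B)) ⟩
    ∑[ i < suc (B ℕ.+ B) ] slice t (+ i - + B)
      ≡⟨ cong (λ l → ∑[ i < l ] slice t (+ i - + B)) (sym (ℕP.+-suc B B)) ⟩
    ∑[ i < B ℕ.+ suc B ] slice t (+ i - + B)
      ≡⟨ ∑-split (λ i → slice t (+ i - + B)) B (suc B) ⟩
    (∑[ i < B ] slice t (+ i - + B)) + (∑[ i < suc B ] slice t (+ (B ℕ.+ i) - + B))
      ≡⟨ cong₂ _+_ (∑-zero B negative) (∑-cong (suc B) (λ i _ → cong (slice t) (cancel (+ B) (+ i)))) ⟩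
    0ℤ + (∑[ i < suc B ] slice t (+ i))
      ≡⟨ ℤP.+-identityˡ _ ⟩
    ∑[ i < suc B ] slice t (+ i)
      ∎
    where
    open ≡-Reasoning
    B : ℕ
    B = box t
    gap : ∀ i B → 0ℤ - (i - B) - 1ℤ ≡ B - (1ℤ + i)
    gap = solve-∀
    negative : ∀ i → i ℕ.< B → slice t (+ i - + B) ≡ 0ℤ
    negative i i<B = slice-neg t (<-witness (+ B - + suc i) (gap (+ i) (+ B)) (ℤP.i≤j⇒0≤j-i (+≤+ i<B)))
    cancel : ∀ B i → B + i - B ≡ i
    cancel = solve-∀

  ehrhart≡ : ∀ t → + ehrhart p N t ≡ ∑[ j < n ] simplexCount (suc k) (+ t + offset j)
  ehrhart≡ t = begin
    + ehrhart p N t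
      ≡⟨ ehrhart≡∑slices t ⟩
    ∑[ i < suc (box t) ] slice t (+ i)
      ≡⟨ ∑-extend (slice t ∘ +_) nt<1+box (slice-high t) ⟩
    ∑[ i < suc (n ℕ.* t) ] slice t (+ i)
      ≡⟨ sym (∑-extend (slice t ∘ +_) nt<[1+t]n (slice-high t)) ⟩
    ∑[ i < suc t ℕ.* n ] slice t (+ i)
      ≡⟨ ∑-blocks (slice t ∘ +_) n (suc t) ⟩
    ∑[ s < suc t ] ∑[ j < n ] slice t (+ (s ℕ.* n ℕ.+ j))
      ≡⟨ ∑-swap (λ s j → slice t (+ (s ℕ.* n ℕ.+ j))) n (suc t) ⟩
    ∑[ j < n ] ∑[ s < suc t ] slice t (+ (s ℕ.* n ℕ.+ j))
      ≡⟨ ∑-cong n (λ j _ → ∑-column t j) ⟩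
    ∑[ j < n ] simplexCount (suc k) (+ t + offset j)
      ∎
    where
    open ≡-Reasoning
    nt<1+box : suc (n ℕ.* t) ℕ.≤ suc (box t)
    nt<1+box = s≤s (ℕP.≤-trans (ℕP.≤-reflexive (ℕP.*-comm n t))
                               (ℕP.*-monoʳ-≤ t (ℕP.≤-trans (ℕP.m≤m+n n M) (ℕP.n≤1+n _))))
    nt<[1+t]n : suc (n ℕ.* t) ℕ.≤ suc t ℕ.* n
    nt<[1+t]n = subst (suc (n ℕ.* t) ℕ.≤_) (cong (n ℕ.+_) (ℕP.*-comm n t))
                      (ℕP.+-monoˡ-≤ (n ℕ.* t) (ℕ.>-nonZero⁻¹ n))

  ehrhartSeries≡ : ∀ t → ehrhartSeries p N t ≡ ∑[ j < n ] simplexCount (suc k) (+ t + offset j)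
  ehrhartSeries≡ (suc t) = ehrhart≡ (suc t)
  ehrhartSeries≡ zero    = sym (begin
    ∑[ j < n ] f j                               ≡⟨ cong (λ l → ∑ l f) (sym (ℕP.suc-pred n)) ⟩
    f 0 + (∑[ j < ℕ.pred n ] f (suc j))          ≡⟨ cong₂ _+_ origin (∑-zero (ℕ.pred n) (λ j _ → simplexCount-neg (suc k) (subst (_< 0ℤ) (sym (ℤP.+-identityˡ _)) (offset-suc j)))) ⟩
    1ℤ + 0ℤ                                      ≡⟨⟩
    1ℤ                                           ∎)
    where
    open ≡-Reasoning
    f : ℕ → ℤ
    f j = simplexCount (suc k) (0ℤ + offset j)
    origin : f 0 ≡ 1ℤ
    origin = trans (cong (λ e → simplexCount (suc k) (0ℤ + e)) offset-zero) (simplexCount-origin (suc k))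

  hstar-coefficient : ∀ m → hstarℕ p N m ≡ ∑[ j < n ] δ (- offset j) (+ m)
  hstar-coefficient m = begin
    hstarℕ p N m
      ≡⟨ hstarℕ≡binomialDifference p N m ⟩
    binomialDifference (suc (suc k)) (ehrhartSeries p N) m
      ≡⟨ binomialDifference≡∇^ (suc (suc k)) (ehrhartSeries p N) m ⟩
    ∇^ (suc (suc k)) (ehrhartSeries p N) m
      ≡⟨ ∇^-cong (suc (suc k)) ehrhartSeries≡ m ⟩
    ∇^ (suc (suc k)) (λ t → ∑[ j < n ] simplexCount (suc k) (+ t + offset j)) m
      ≡⟨ ∇^-∑ (suc (suc k)) (λ j t → simplexCount (suc k) (+ t + offset j)) n m ⟩
    ∑[ j < n ] ∇^ (suc (suc k)) (λ t → simplexCount (suc k) (+ t + offset j)) m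
      ≡⟨ ∑-cong n (λ j _ → trans (∇^-simplexCount (suc k) (offset-nonPos j) m) (δ-+-0 (+ m) (offset j))) ⟩
    ∑[ j < n ] δ (- offset j) (+ m)
      ∎
    where open ≡-Reasoning


  -offset-nonNeg : ∀ j → 0ℤ ≤ - offset j
  -offset-nonNeg j = ℤP.neg-mono-≤ (offset-nonPos j)

  hstar≡monomials : ∀ e → hstar p N e ≡ monomials n (λ j → - offset j) e
  hstar≡monomials (+ m)    = hstar-coefficient m
  hstar≡monomials -[1+ x ] = sym (monomials-absent n (λ j → - offset j) -[1+ x ]
    (λ j _ -offset≡e → ℤP.<⇒≱ ℤ.-<+ (subst (0ℤ ≤_) -offset≡e (-offset-nonNeg j))))

  PolyValueAt1-hstar : PolyValueAt1 (hstar p N) (+ n)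
  PolyValueAt1-hstar = PolyValueAt1-cong (sym ∘ hstar≡monomials)
    (PolyValueAt1-monomials n (λ j → - offset j) (λ j _ → -offset-nonNeg j))

sumV-∷ʳ : ∀ {m} (v : Vec ℤ m) x → sumV (v V.∷ʳ x) ≡ sumV v + x
sumV-∷ʳ []      x = trans (ℤP.+-identityʳ x) (sym (ℤP.+-identityˡ x))
sumV-∷ʳ (q ∷ v) x = trans (cong (_+_ q) (sumV-∷ʳ v x)) (sym (ℤP.+-assoc q (sumV v) x))

module Exponents {k} (qs : Vec ℤ k) (n : ℕ) .{{_ : NonZero n}} where
  open DivisionBy n

  sum-qAll : sumV (qAll qs n) ≡ 1ℤ
  sum-qAll = trans (sumV-∷ʳ qs (qd qs n)) (cancel (sumV qs))
    where
    cancel : ∀ s → s + (1ℤ - s) ≡ 1ℤ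
    cancel = solve-∀

  ceil-sum-bound : ∀ j {m} (v : Vec ℤ m) →
    (+ j + 1ℤ) * sumV v ≤ N * sumV (V.map (λ qi → ⌈ qi * + j + qi ⁺ ⌉) v)
  ceil-sum-bound j []      = ℤP.≤-reflexive (trans (ℤP.*-zeroʳ (+ j + 1ℤ)) (sym (ℤP.*-zeroʳ N)))
  ceil-sum-bound j (q ∷ v) = subst₂ _≤_
    (sym (ℤP.*-distribˡ-+ (+ j + 1ℤ) q (sumV v)))
    (sym (ℤP.*-distribˡ-+ N ⌈ q * + j + q ⁺ ⌉ _))
    (ℤP.+-mono-≤ term (ceil-sum-bound j v))
    where
    expand : ∀ q j → (j + 1ℤ) * q ≡ q * j + q
    expand = solve-∀
    term : (+ j + 1ℤ) * q ≤ N * ⌈ q * + j + q ⁺ ⌉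
    term = ℤP.≤-trans (subst (_≤ q * + j + q ⁺) (sym (expand q (+ j))) (ℤP.+-monoʳ-≤ (q * + j) (ℤP.i≤i⊔j q 0ℤ)))
                      (≤N*⌈⌉ (q * + j + q ⁺))

  -- q₁ + ⋯ + q_d = 1 gives n · expo j ≥ j + 1 > 0.
  expo-positive : ∀ j → 1ℤ ≤ expo qs n j
  expo-positive j = ℤP.i<j⇒suc[i]≤j (ℤP.*-cancelˡ-<-nonNeg N (subst (_< N * expo qs n j) (sym (ℤP.*-zeroʳ N))
    (ℤP.<-≤-trans (+<+ (s≤s z≤n)) (subst (_≤ N * expo qs n j) j+1≡ (ceil-sum-bound j (qAll qs n))))))
    where
    j+1≡ : (+ j + 1ℤ) * sumV (qAll qs n) ≡ + suc j
    j+1≡ = trans (cong (_*_ (+ j + 1ℤ)) sum-qAll) (trans (ℤP.*-identityʳ _) (ℤP.+-comm (+ j) 1ℤ))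

proposition5p3 : (k n : ℕ) .{{_ : NonZero n}} (qs : Vec ℤ k) →
    (∀ (i : Fin (suc k)) → lookup (qAll qs n) i ∣ + n) →
    PolyValueAt1 (L1 qs n) (+ n) × (L2 qs n 0ℤ ≡ 1ℤ) × PolyValueAt1 (L2 qs n) 0ℤ
proposition5p3 k n qs _ = L1-at-1 , L2-at-0 , L2-at-1
  where
  open Dilate n qs using (PolyValueAt1-hstar)
  open Exponents qs n using (expo-positive)
  expo-nonNeg : ∀ j → 0ℤ ≤ expo qs n j
  expo-nonNeg j = ℤP.≤-trans (+≤+ z≤n) (expo-positive j)
  L1-at-1 : PolyValueAt1 (L1 qs n) (+ n)
  L1-at-1 = PolyValueAt1-cong (λ e → sym (countB-≟≡monomials n (λ j → expo qs n j - 1ℤ) e))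
    (PolyValueAt1-monomials n (λ j → expo qs n j - 1ℤ) (λ j _ → ℤP.i≤j⇒0≤j-i (expo-positive j)))
  -- The constant coefficient of h* computes to 1.
  L2-at-0 : L2 qs n 0ℤ ≡ 1ℤ
  L2-at-0 = cong (_-_ 1ℤ) (trans (countB-≟≡monomials n (expo qs n) 0ℤ)
    (monomials-absent n (expo qs n) 0ℤ (λ j _ expo≡0 → ℤP.<⇒≱ (+<+ (s≤s z≤n)) (subst (1ℤ ≤_) expo≡0 (expo-positive j)))))
  L2-at-1 : PolyValueAt1 (L2 qs n) 0ℤ
  L2-at-1 = subst (PolyValueAt1 (L2 qs n)) (ℤP.+-inverseʳ (+ n))
    (PolyValueAt1-cong (λ e → cong (_-_ (hstar qs (+ n) e)) (sym (countB-≟≡monomials n (expo qs n) e)))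
      (PolyValueAt1-sub PolyValueAt1-hstar (PolyValueAt1-monomials n (expo qs n) (λ j _ → expo-nonNeg j))))
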